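{- Let $A$ be a ring of rank $n$. Then $\operatorname{disc}(A) \equiv 0$ or $1 \pmod{4}$.
   Context: Rings are associative with multiplicative identity $1$, not necessarily commutative. For $n \in \mathbb{Z}_{\geq 1}$, a ring of rank $n$ is a ring whose additive group is isomorphic to $\mathbb{Z}^n$. A basis $\beta=(e_1,\dots,e_n)$ of $A$ is an ordered $\mathbb{Z}$-basis of its additive group. For $a\in A$, its matrix $\lambda_\beta(a)=(a_{ij})\in \mathrm{M}_n(\mathbb{Z})$ is defined by $a e_j=\sum_{i=1}^n a_{ij}e_i$. The trace pairing is $t_\beta(a,b)=\operatorname{Tr}(\lambda_\beta(ab))$, the Gram matrix is $B(A,\beta)=(t_\beta(e_i,e_j))_{i,j=1}^n$, and the discriminant is $\operatorname{disc}(A)=\det B(A,\beta)$ (independent of the choice of basis). -}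

module Defs where

open import Level using (Level; _⊔_)
open import Data.Nat as ℕ using (ℕ; zero; suc)
open import Data.Fin using (Fin; zero; suc; toℕ; punchIn)
open import Data.Integer as ℤ using (ℤ; +_; -[1+_]; _-_)
open import Algebra.Bundles using (Ring)
open import Relation.Binary.PropositionalEquality using (_≡_)

sumℤ : ∀ {n} → (Fin n → ℤ) → ℤ
sumℤ {zero}  f = + 0
sumℤ {suc n} f = f zero ℤ.+ sumℤ (λ i → f (suc i))

det : ∀ {n} → (Fin n → Fin n → ℤ) → ℤ
det {zero}  M = + 1
det {suc n} M =
  sumℤ (λ j → (ℤ.- + 1) ℤ.^ toℕ j ℤ.* M zero j ℤ.* det (λ i k → M (suc i) (punchIn j k)))

module _ {c ℓ : Level} (R : Ring c ℓ) where
  open Ring R using (Carrier; _≈_; _+_; _*_; -_; 0#)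

  nmul : ℕ → Carrier → Carrier
  nmul zero    x = 0#
  nmul (suc k) x = x + nmul k x

  zmul : ℤ → Carrier → Carrier
  zmul (+ k)      x = nmul k x
  zmul (-[1+ k ]) x = - nmul (suc k) x

  sumR : ∀ {n} → (Fin n → Carrier) → Carrier
  sumR {zero}  f = 0#
  sumR {suc n} f = f zero + sumR (λ i → f (suc i))

  -- An ordered ℤ-basis (e_1,…,e_n) of the additive group of R, with coordinate map.
  -- Existence of such a basis is exactly "the additive group of R is isomorphic to ℤ^n".
  record Basis (n : ℕ) : Set (c ⊔ ℓ) where
    field
      e          : Fin n → Carrier
      coord      : Carrier → Fin n → ℤ
      coord-cong : ∀ {x y} → x ≈ y → ∀ i → coord x i ≡ coord y i
      expand     : ∀ x → x ≈ sumR (λ i → zmul (coord x i) (e i))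
      unique     : ∀ (a : Fin n → ℤ) i → coord (sumR (λ j → zmul (a j) (e j))) i ≡ a i

  module _ {n : ℕ} (β : Basis n) where
    open Basis β

    lam : Carrier → Fin n → Fin n → ℤ
    lam a i j = coord (a * e j) i

    trace : (Fin n → Fin n → ℤ) → ℤ
    trace M = sumℤ (λ i → M i i)

    tpair : Carrier → Carrier → ℤ
    tpair a b = trace (lam (a * b))

    gram : Fin n → Fin n → ℤ
    gram i j = tpair (e i) (e j)

    disc : ℤ
    disc = det gram

{-# OPTIONS --safe #-}
module Submission where

open import Defs
open import Level using (Level)
open import Data.Nat as ℕ using (ℕ; zero; suc; _≤_)
import Data.Nat.Properties as ℕP
import Data.Nat.Divisibility as ℕ∣
open import Data.Fin as Fin using (Fin; zero; suc; punchIn; toℕ)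
import Data.Fin.Properties as FinP
open import Data.Fin.Properties using (any?)
open import Data.Fin.Patterns using (0F; 1F; 2F; 3F; 4F; 5F; 6F; 7F; 8F; 9F)
open import Data.Fin.Permutation as Perm using ()
open import Data.Fin.Permutation.Components using (transpose)
open import Data.Vec.Functional using (Vector; []; _∷_; updateAt)
open import Data.Vec.Functional.Properties using (updateAt-updates; updateAt-minimal)
open import Data.Integer as ℤ using (ℤ; +_; -[1+_]; _+_; _*_; -_; _-_; _⊖_)
import Data.Integer.Properties as ℤP
open import Data.Integer.Tactic.RingSolver using (solve-∀)
open import Data.Integer.Divisibility using (_∣_)
open import Data.Bool using (Bool; true; false; _xor_; _∧_)
import Data.Bool.Properties as 𝔹
open import Data.Product using (_×_; _,_; proj₁; proj₂; ∃)
open import Data.Unit using (⊤; tt)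
open import Data.Sum as Sum using (_⊎_)
open import Algebra.Bundles using (Ring)
import Algebra.Properties.Semiring.Sum as SemiringSum
import Algebra.Properties.Semiring.Mult as SemiringMult
import Algebra.Properties.Ring as RingProperties
import Algebra.Properties.CommutativeSemigroup as CommutativeSemigroupProperties
import Relation.Binary.Reasoning.Setoid as SetoidReasoning
import Algebra.Properties.AbelianGroup ℤP.+-0-abelianGroup as ℤGroup
open import Function using (_∘_)
open import Relation.Nullary using (Dec; yes; no; contradiction)
open import Relation.Nullary.Decidable using (map′; _×-dec_; _→-dec_; _⊎-dec_; from-yes; dec-true; dec-false)
open import Relation.Binary.Definitions using (DecidableEquality)
open import Relation.Binary.PropositionalEquality
open ≡-Reasoning

-- Let B be the Gram matrix of the trace form and w the coordinates of 1. Then B is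
-- symmetric, w is characteristic for B, i.e. B_ii = Tr (λ(e_i)²) ≡ Tr λ(e_i) = (B w)_i
-- (mod 2), and wᵀ B w = Tr 1 = n. For every symmetric integer matrix B of size n with a
-- characteristic vector w, D = det B satisfies D² ≡ D (1 + wᵀ B w - n) (mod 4). This is
-- proved by induction on n: after a simultaneous permutation of rows and columns, row
-- operations split off, modulo 4, either a 1×1 block with odd entry or a 2×2 block with
-- odd determinant; the relation holds for the block by direct computation and is
-- multiplicative over such a splitting. If all entries are even, D ≡ 0 (mod 4).
-- For the trace form this reads disc² ≡ disc (mod 4).

-- Arithmetic modulo 4

data ℤ₄ : Set where
  0₄ 1₄ 2₄ 3₄ : ℤ₄

infixl 6 _+₄_
infixl 7 _*₄_
infix 8 -₄_
infix 4 _≟₄_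

suc₄ : ℤ₄ → ℤ₄
suc₄ 0₄ = 1₄
suc₄ 1₄ = 2₄
suc₄ 2₄ = 3₄
suc₄ 3₄ = 0₄

_+₄_ : ℤ₄ → ℤ₄ → ℤ₄
0₄ +₄ y = y
1₄ +₄ y = suc₄ y
2₄ +₄ y = suc₄ (suc₄ y)
3₄ +₄ y = suc₄ (suc₄ (suc₄ y))

_*₄_ : ℤ₄ → ℤ₄ → ℤ₄
0₄ *₄ y = 0₄
1₄ *₄ y = y
2₄ *₄ y = y +₄ y
3₄ *₄ y = y +₄ y +₄ y

-₄_ : ℤ₄ → ℤ₄
-₄ 0₄ = 0₄
-₄ 1₄ = 3₄
-₄ 2₄ = 2₄
-₄ 3₄ = 1₄

odd₄ : ℤ₄ → Bool
odd₄ 1₄ = true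
odd₄ 3₄ = true
odd₄ _  = false

_≟₄_ : DecidableEquality ℤ₄
0₄ ≟₄ 0₄ = yes refl
1₄ ≟₄ 1₄ = yes refl
2₄ ≟₄ 2₄ = yes refl
3₄ ≟₄ 3₄ = yes refl
0₄ ≟₄ 1₄ = no λ ()
0₄ ≟₄ 2₄ = no λ ()
0₄ ≟₄ 3₄ = no λ ()
1₄ ≟₄ 0₄ = no λ ()
1₄ ≟₄ 2₄ = no λ ()
1₄ ≟₄ 3₄ = no λ ()
2₄ ≟₄ 0₄ = no λ ()
2₄ ≟₄ 1₄ = no λ ()
2₄ ≟₄ 3₄ = no λ ()
3₄ ≟₄ 0₄ = no λ ()
3₄ ≟₄ 1₄ = no λ ()
3₄ ≟₄ 2₄ = no λ ()

∀₄? : {P : ℤ₄ → Set} → (∀ x → Dec (P x)) → Dec (∀ x → P x)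
∀₄? P? = map′ (λ { (p₀ , p₁ , p₂ , p₃) → λ { 0₄ → p₀ ; 1₄ → p₁ ; 2₄ → p₂ ; 3₄ → p₃ } })
              (λ p → p 0₄ , p 1₄ , p 2₄ , p 3₄)
              (P? 0₄ ×-dec P? 1₄ ×-dec P? 2₄ ×-dec P? 3₄)

∀𝔹? : {P : Bool → Set} → (∀ x → Dec (P x)) → Dec (∀ x → P x)
∀𝔹? P? = map′ (λ { (p₀ , p₁) → λ { false → p₀ ; true → p₁ } }) (λ p → p false , p true) (P? false ×-dec P? true)

+₄-comm : ∀ x y → x +₄ y ≡ y +₄ x
+₄-comm = from-yes (∀₄? λ x → ∀₄? λ y → x +₄ y ≟₄ y +₄ x)

-₄-*₄-distribʳ : ∀ x y → x *₄ -₄ y ≡ -₄ (x *₄ y)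
-₄-*₄-distribʳ = from-yes (∀₄? λ x → ∀₄? λ y → x *₄ -₄ y ≟₄ -₄ (x *₄ y))

+₄-cancelʳ : ∀ x y z → x +₄ z ≡ y +₄ z → x ≡ y
+₄-cancelʳ = from-yes (∀₄? λ x → ∀₄? λ y → ∀₄? λ z → (x +₄ z ≟₄ y +₄ z) →-dec (x ≟₄ y))

+₄-identityʳ : ∀ x → x +₄ 0₄ ≡ x
+₄-identityʳ = from-yes (∀₄? λ x → x +₄ 0₄ ≟₄ x)

-₄-inverseˡ : ∀ x → -₄ x +₄ x ≡ 0₄
-₄-inverseˡ = from-yes (∀₄? λ x → -₄ x +₄ x ≟₄ 0₄)

-₄-distrib-+₄ : ∀ x y → -₄ (x +₄ y) ≡ -₄ x +₄ -₄ y
-₄-distrib-+₄ = from-yes (∀₄? λ x → ∀₄? λ y → -₄ (x +₄ y) ≟₄ -₄ x +₄ -₄ y)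

*₄-zeroʳ : ∀ x → x *₄ 0₄ ≡ 0₄
*₄-zeroʳ = from-yes (∀₄? λ x → x *₄ 0₄ ≟₄ 0₄)

*₄-suc₄ : ∀ x y → x *₄ suc₄ y ≡ x +₄ x *₄ y
*₄-suc₄ = from-yes (∀₄? λ x → ∀₄? λ y → x *₄ suc₄ y ≟₄ x +₄ x *₄ y)

suc₄-+₄ : ∀ x y → suc₄ x +₄ y ≡ suc₄ (x +₄ y)
suc₄-+₄ = from-yes (∀₄? λ x → ∀₄? λ y → suc₄ x +₄ y ≟₄ suc₄ (x +₄ y))

suc₄-+₄-₄suc₄ : ∀ x y → suc₄ x +₄ -₄ suc₄ y ≡ x +₄ -₄ y
suc₄-+₄-₄suc₄ = from-yes (∀₄? λ x → ∀₄? λ y → suc₄ x +₄ -₄ suc₄ y ≟₄ x +₄ -₄ y)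

[_]ℕ₄ : ℕ → ℤ₄
[ zero ]ℕ₄  = 0₄
[ suc n ]ℕ₄ = suc₄ [ n ]ℕ₄

[_]₄ : ℤ → ℤ₄
[ + n ]₄      = [ n ]ℕ₄
[ -[1+ n ] ]₄ = -₄ [ suc n ]ℕ₄

[+]ℕ₄ : ∀ m n → [ m ℕ.+ n ]ℕ₄ ≡ [ m ]ℕ₄ +₄ [ n ]ℕ₄
[+]ℕ₄ zero    n = refl
[+]ℕ₄ (suc m) n = trans (cong suc₄ ([+]ℕ₄ m n)) (sym (suc₄-+₄ [ m ]ℕ₄ [ n ]ℕ₄))

[⊖]₄ : ∀ m n → [ m ⊖ n ]₄ ≡ [ m ]ℕ₄ +₄ -₄ [ n ]ℕ₄
[⊖]₄ m       zero    = sym (+₄-identityʳ [ m ]ℕ₄)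
[⊖]₄ zero    (suc n) = refl
[⊖]₄ (suc m) (suc n) = begin
  [ suc m ⊖ suc n ]₄                 ≡⟨ cong [_]₄ (ℤP.[1+m]⊖[1+n]≡m⊖n m n) ⟩
  [ m ⊖ n ]₄                         ≡⟨ [⊖]₄ m n ⟩
  [ m ]ℕ₄ +₄ -₄ [ n ]ℕ₄              ≡⟨ suc₄-+₄-₄suc₄ [ m ]ℕ₄ [ n ]ℕ₄ ⟨
  [ suc m ]ℕ₄ +₄ -₄ [ suc n ]ℕ₄      ∎

[+]₄ : ∀ x y → [ x + y ]₄ ≡ [ x ]₄ +₄ [ y ]₄
[+]₄ (+ m)      (+ n)      = [+]ℕ₄ m n
[+]₄ (+ m)      -[1+ n ]   = [⊖]₄ m (suc n)
[+]₄ -[1+ m ]   (+ n)      = trans ([⊖]₄ n (suc m)) (+₄-comm [ n ]ℕ₄ _)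
[+]₄ -[1+ m ]   -[1+ n ]   = begin
  -₄ [ suc (suc (m ℕ.+ n)) ]ℕ₄             ≡⟨ cong (λ k → -₄ [ suc k ]ℕ₄) (ℕP.+-suc m n) ⟨
  -₄ [ suc m ℕ.+ suc n ]ℕ₄                 ≡⟨ cong -₄_ ([+]ℕ₄ (suc m) (suc n)) ⟩
  -₄ ([ suc m ]ℕ₄ +₄ [ suc n ]ℕ₄)          ≡⟨ -₄-distrib-+₄ [ suc m ]ℕ₄ [ suc n ]ℕ₄ ⟩
  -₄ [ suc m ]ℕ₄ +₄ -₄ [ suc n ]ℕ₄         ∎

[-]₄ : ∀ x → [ - x ]₄ ≡ -₄ [ x ]₄
[-]₄ x = +₄-cancelʳ _ _ [ x ]₄ (begin
  [ - x ]₄ +₄ [ x ]₄        ≡⟨ [+]₄ (- x) x ⟨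
  [ - x + x ]₄              ≡⟨ cong [_]₄ (ℤP.+-inverseˡ x) ⟩
  0₄                        ≡⟨ -₄-inverseˡ [ x ]₄ ⟨
  -₄ [ x ]₄ +₄ [ x ]₄       ∎)

[*+]₄ : ∀ x n → [ x * + n ]₄ ≡ [ x ]₄ *₄ [ n ]ℕ₄
[*+]₄ x zero    = trans (cong [_]₄ (ℤP.*-zeroʳ x)) (sym (*₄-zeroʳ [ x ]₄))
[*+]₄ x (suc n) = begin
  [ x * + suc n ]₄                    ≡⟨ cong [_]₄ (ℤP.*-suc x (+ n)) ⟩
  [ x + x * + n ]₄                    ≡⟨ [+]₄ x (x * + n) ⟩
  [ x ]₄ +₄ [ x * + n ]₄              ≡⟨ cong ([ x ]₄ +₄_) ([*+]₄ x n) ⟩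
  [ x ]₄ +₄ [ x ]₄ *₄ [ n ]ℕ₄         ≡⟨ *₄-suc₄ [ x ]₄ [ n ]ℕ₄ ⟨
  [ x ]₄ *₄ [ suc n ]ℕ₄               ∎

[*]₄ : ∀ x y → [ x * y ]₄ ≡ [ x ]₄ *₄ [ y ]₄
[*]₄ x (+ n)     = [*+]₄ x n
[*]₄ x -[1+ n ]  = begin
  [ x * - + suc n ]₄                  ≡⟨ cong [_]₄ (ℤP.neg-distribʳ-* x (+ suc n)) ⟨
  [ - (x * + suc n) ]₄                ≡⟨ [-]₄ (x * + suc n) ⟩
  -₄ [ x * + suc n ]₄                 ≡⟨ cong -₄_ ([*+]₄ x (suc n)) ⟩
  -₄ ([ x ]₄ *₄ [ suc n ]ℕ₄)          ≡⟨ -₄-*₄-distribʳ [ x ]₄ [ suc n ]ℕ₄ ⟨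
  [ x ]₄ *₄ -₄ [ suc n ]ℕ₄            ∎

[_]ℕ₄≡0₄⇒4∣ : ∀ n → [ n ]ℕ₄ ≡ 0₄ → 4 ℕ∣.∣ n
[ zero ]ℕ₄≡0₄⇒4∣ _ = 4 ℕ∣.∣0
[ suc (suc (suc (suc n))) ]ℕ₄≡0₄⇒4∣ e =
  ℕ∣.∣m∣n⇒∣m+n ℕ∣.∣-refl ([ n ]ℕ₄≡0₄⇒4∣ (trans (sym (suc₄⁴ [ n ]ℕ₄)) e))
  where
  suc₄⁴ : ∀ x → suc₄ (suc₄ (suc₄ (suc₄ x))) ≡ x
  suc₄⁴ = from-yes (∀₄? λ x → suc₄ (suc₄ (suc₄ (suc₄ x))) ≟₄ x)
[ 1 ]ℕ₄≡0₄⇒4∣ ()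
[ 2 ]ℕ₄≡0₄⇒4∣ ()
[ 3 ]ℕ₄≡0₄⇒4∣ ()

[_]₄≡0₄⇒4∣ : ∀ x → [ x ]₄ ≡ 0₄ → + 4 ∣ x
[ + n ]₄≡0₄⇒4∣      e = [ n ]ℕ₄≡0₄⇒4∣ e
[ -[1+ n ] ]₄≡0₄⇒4∣ e = [ suc n ]ℕ₄≡0₄⇒4∣ (-₄-injective-0₄ _ e)
  where
  -₄-injective-0₄ : ∀ y → -₄ y ≡ 0₄ → y ≡ 0₄
  -₄-injective-0₄ = from-yes (∀₄? λ y → (-₄ y ≟₄ 0₄) →-dec (y ≟₄ 0₄))

[_]₄≡1₄⇒4∣-1 : ∀ x → [ x ]₄ ≡ 1₄ → + 4 ∣ x - + 1
[ x ]₄≡1₄⇒4∣-1 e = [ x - + 1 ]₄≡0₄⇒4∣ (trans ([+]₄ x (- + 1)) (cong (_+₄ 3₄) e))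

parity : ℤ → Bool
parity x = odd₄ [ x ]₄

-- Polynomial expressions

infixl 6 _:+_
infixl 7 _:*_
infix 8 :-_

data Expr (k : ℕ) : Set where
  var       : Fin k → Expr k
  _:+_ _:*_ : Expr k → Expr k → Expr k
  :-_       : Expr k → Expr k

module _ {A : Set} (_⊕_ _⊗_ : A → A → A) (⊝_ : A → A) where

  eval : ∀ {k} → Expr k → Vector A k → A
  eval (var i)  ρ = ρ i
  eval (e :+ f) ρ = eval e ρ ⊕ eval f ρ
  eval (e :* f) ρ = eval e ρ ⊗ eval f ρ
  eval (:- e)   ρ = ⊝ eval e ρ

⟦_⟧ : ∀ {k} → Expr k → Vector ℤ k → ℤ
⟦_⟧ = eval _+_ _*_ (λ x → - x)

⟦_⟧₄ : ∀ {k} → Expr k → Vector ℤ₄ k → ℤ₄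
⟦_⟧₄ = eval _+₄_ _*₄_ -₄_

⟦_⟧₂ : ∀ {k} → Expr k → Vector Bool k → Bool
⟦_⟧₂ = eval _xor_ _∧_ (λ b → b)

[⟦⟧]₄ : ∀ {k} (e : Expr k) ρ → [ ⟦ e ⟧ ρ ]₄ ≡ ⟦ e ⟧₄ (λ i → [ ρ i ]₄)
[⟦⟧]₄ (var i)  ρ = refl
[⟦⟧]₄ (e :+ f) ρ = trans ([+]₄ (⟦ e ⟧ ρ) (⟦ f ⟧ ρ)) (cong₂ _+₄_ ([⟦⟧]₄ e ρ) ([⟦⟧]₄ f ρ))
[⟦⟧]₄ (e :* f) ρ = trans ([*]₄ (⟦ e ⟧ ρ) (⟦ f ⟧ ρ)) (cong₂ _*₄_ ([⟦⟧]₄ e ρ) ([⟦⟧]₄ f ρ))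
[⟦⟧]₄ (:- e)   ρ = trans ([-]₄ (⟦ e ⟧ ρ)) (cong -₄_ ([⟦⟧]₄ e ρ))

odd₄⟦⟧₄ : ∀ {k} (e : Expr k) ρ → odd₄ (⟦ e ⟧₄ ρ) ≡ ⟦ e ⟧₂ (λ i → odd₄ (ρ i))
odd₄⟦⟧₄ (var i)  ρ = refl
odd₄⟦⟧₄ (e :+ f) ρ = trans (odd₄-+₄ (⟦ e ⟧₄ ρ) (⟦ f ⟧₄ ρ)) (cong₂ _xor_ (odd₄⟦⟧₄ e ρ) (odd₄⟦⟧₄ f ρ))
  where
  odd₄-+₄ : ∀ x y → odd₄ (x +₄ y) ≡ odd₄ x xor odd₄ y
  odd₄-+₄ = from-yes (∀₄? λ x → ∀₄? λ y → odd₄ (x +₄ y) 𝔹.≟ odd₄ x xor odd₄ y)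
odd₄⟦⟧₄ (e :* f) ρ = trans (odd₄-*₄ (⟦ e ⟧₄ ρ) (⟦ f ⟧₄ ρ)) (cong₂ _∧_ (odd₄⟦⟧₄ e ρ) (odd₄⟦⟧₄ f ρ))
  where
  odd₄-*₄ : ∀ x y → odd₄ (x *₄ y) ≡ odd₄ x ∧ odd₄ y
  odd₄-*₄ = from-yes (∀₄? λ x → ∀₄? λ y → odd₄ (x *₄ y) 𝔹.≟ odd₄ x ∧ odd₄ y)
odd₄⟦⟧₄ (:- e)   ρ = trans (odd₄--₄ (⟦ e ⟧₄ ρ)) (odd₄⟦⟧₄ e ρ)
  where
  odd₄--₄ : ∀ x → odd₄ (-₄ x) ≡ odd₄ x
  odd₄--₄ = from-yes (∀₄? λ x → odd₄ (-₄ x) 𝔹.≟ odd₄ x)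

parity⟦⟧ : ∀ {k} (e : Expr k) ρ → parity (⟦ e ⟧ ρ) ≡ ⟦ e ⟧₂ (λ i → parity (ρ i))
parity⟦⟧ e ρ = trans (cong odd₄ ([⟦⟧]₄ e ρ)) (odd₄⟦⟧₄ e (λ i → [ ρ i ]₄))

-- Finite sums

module Σ = SemiringSum ℤP.+-*-semiring

sumℤ≡sum : ∀ {n} (f : Fin n → ℤ) → sumℤ f ≡ Σ.sum f
sumℤ≡sum {zero}  f = refl
sumℤ≡sum {suc n} f = cong (_+_ (f zero)) (sumℤ≡sum (λ i → f (suc i)))

sumℤ-cong : ∀ {n} {f g : Fin n → ℤ} → (∀ i → f i ≡ g i) → sumℤ f ≡ sumℤ g
sumℤ-cong {f = f} {g} f≗g = begin
  sumℤ f  ≡⟨ sumℤ≡sum f ⟩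
  Σ.sum f ≡⟨ Σ.sum-cong-≗ f≗g ⟩
  Σ.sum g ≡⟨ sumℤ≡sum g ⟨
  sumℤ g  ∎

sumℤ-distrib-+ : ∀ {n} (f g : Fin n → ℤ) → sumℤ (λ i → f i + g i) ≡ sumℤ f + sumℤ g
sumℤ-distrib-+ f g = begin
  sumℤ (λ i → f i + g i)  ≡⟨ sumℤ≡sum (λ i → f i + g i) ⟩
  Σ.sum (λ i → f i + g i) ≡⟨ Σ.∑-distrib-+ f g ⟩
  Σ.sum f + Σ.sum g       ≡⟨ cong₂ _+_ (sumℤ≡sum f) (sumℤ≡sum g) ⟨
  sumℤ f + sumℤ g         ∎

*-distribˡ-sumℤ : ∀ {n} c (f : Fin n → ℤ) → c * sumℤ f ≡ sumℤ (λ i → c * f i)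
*-distribˡ-sumℤ c f = begin
  c * sumℤ f             ≡⟨ cong (_*_ c) (sumℤ≡sum f) ⟩
  c * Σ.sum f            ≡⟨ Σ.*-distribˡ-sum c f ⟩
  Σ.sum (λ i → c * f i)  ≡⟨ sumℤ≡sum (λ i → c * f i) ⟨
  sumℤ (λ i → c * f i)   ∎

neg-sumℤ : ∀ {n} (f : Fin n → ℤ) → - sumℤ f ≡ sumℤ (λ i → - f i)
neg-sumℤ f = begin
  - sumℤ f                  ≡⟨ ℤP.-1*i≡-i (sumℤ f) ⟨
  ℤ.-1ℤ * sumℤ f            ≡⟨ *-distribˡ-sumℤ ℤ.-1ℤ f ⟩
  sumℤ (λ i → ℤ.-1ℤ * f i)  ≡⟨ sumℤ-cong (λ i → ℤP.-1*i≡-i (f i)) ⟩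
  sumℤ (λ i → - f i)        ∎

sumℤ-zero : ∀ {n} (f : Fin n → ℤ) → (∀ i → f i ≡ + 0) → sumℤ f ≡ + 0
sumℤ-zero {zero}  f f≗0 = refl
sumℤ-zero {suc n} f f≗0 = cong₂ _+_ (f≗0 zero) (sumℤ-zero (λ i → f (suc i)) (λ i → f≗0 (suc i)))

sumℤ-comm : ∀ {m n} (f : Fin m → Fin n → ℤ) →
            sumℤ (λ i → sumℤ (λ j → f i j)) ≡ sumℤ (λ j → sumℤ (λ i → f i j))
sumℤ-comm f = begin
  sumℤ (λ i → sumℤ (f i))                   ≡⟨ sumℤ-cong (λ i → sumℤ≡sum (f i)) ⟩
  sumℤ (λ i → Σ.sum (f i))                  ≡⟨ sumℤ≡sum (λ i → Σ.sum (f i)) ⟩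
  Σ.sum (λ i → Σ.sum (f i))                 ≡⟨ Σ.∑-comm f ⟩
  Σ.sum (λ j → Σ.sum (λ i → f i j))         ≡⟨ sumℤ≡sum (λ j → Σ.sum (λ i → f i j)) ⟨
  sumℤ (λ j → Σ.sum (λ i → f i j))          ≡⟨ sumℤ-cong (λ j → sumℤ≡sum (λ i → f i j)) ⟨
  sumℤ (λ j → sumℤ (λ i → f i j))           ∎

sumℤ-transpose : ∀ {n} (a b : Fin n) (f : Fin n → ℤ) → sumℤ (λ i → f (transpose a b i)) ≡ sumℤ f
sumℤ-transpose a b f = begin
  sumℤ (λ i → f (transpose a b i))   ≡⟨ sumℤ≡sum (λ i → f (transpose a b i)) ⟩
  Σ.sum (λ i → f (transpose a b i))  ≡⟨ Σ.sum-permute f (Perm.transpose a b) ⟨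
  Σ.sum f                            ≡⟨ sumℤ≡sum f ⟨
  sumℤ f                             ∎

[sumℤ]₄≡0₄ : ∀ {n} (f : Fin n → ℤ) → (∀ i → [ f i ]₄ ≡ 0₄) → [ sumℤ f ]₄ ≡ 0₄
[sumℤ]₄≡0₄ {zero}  f f≡0 = refl
[sumℤ]₄≡0₄ {suc n} f f≡0 =
  trans ([+]₄ (f zero) _) (cong₂ _+₄_ (f≡0 zero) ([sumℤ]₄≡0₄ (λ i → f (suc i)) (λ i → f≡0 (suc i))))

parity-+ : ∀ x y → parity (x + y) ≡ parity x xor parity y
parity-+ x y = parity⟦⟧ (var 0F :+ var 1F) (x ∷ y ∷ [])

parity-sumℤ-cong : ∀ {n} (f g : Fin n → ℤ) → (∀ i → parity (f i) ≡ parity (g i)) → parity (sumℤ f) ≡ parity (sumℤ g)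
parity-sumℤ-cong {zero}  f g f≗g = refl
parity-sumℤ-cong {suc n} f g f≗g = begin
  parity (f zero + sumℤ (λ i → f (suc i)))               ≡⟨ parity-+ (f zero) _ ⟩
  parity (f zero) xor parity (sumℤ (λ i → f (suc i)))    ≡⟨ cong₂ _xor_ (f≗g zero) (parity-sumℤ-cong _ _ (λ i → f≗g (suc i))) ⟩
  parity (g zero) xor parity (sumℤ (λ i → g (suc i)))    ≡⟨ parity-+ (g zero) _ ⟨
  parity (g zero + sumℤ (λ i → g (suc i)))               ∎

parity-sumℤ-even : ∀ {n} (f : Fin n → ℤ) → (∀ i → parity (f i) ≡ false) → parity (sumℤ f) ≡ false
parity-sumℤ-even {n} f even = trans (parity-sumℤ-cong f (λ _ → + 0) even) (cong parity (sumℤ-zero {n} (λ _ → + 0) (λ _ → refl)))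

transpose-matchˡ : ∀ {n} (a b : Fin n) → transpose a b a ≡ b
transpose-matchˡ a b rewrite dec-true (a Fin.≟ a) refl = refl

transpose-matchʳ : ∀ {n} (a b : Fin n) → a ≢ b → transpose a b b ≡ a
transpose-matchʳ a b a≢b rewrite dec-false (b Fin.≟ a) (a≢b ∘ sym) | dec-true (b Fin.≟ b) refl = refl

transpose-other : ∀ {n} (a b i : Fin n) → i ≢ a → i ≢ b → transpose a b i ≡ i
transpose-other a b i i≢a i≢b rewrite dec-false (i Fin.≟ a) i≢a | dec-false (i Fin.≟ b) i≢b = refl

split-at-pair : ∀ {n} {P : Fin n → Set} (a b : Fin n) → P a → P b → (∀ i → i ≢ a → i ≢ b → P i) → ∀ i → P i
split-at-pair a b Pa Pb Pother i with i Fin.≟ a | i Fin.≟ b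
... | yes refl | _        = Pa
... | no _     | yes refl = Pb
... | no i≢a   | no i≢b   = Pother i i≢a i≢b

transpose-involutive : ∀ {n} (a b : Fin n) → a ≢ b → ∀ i → transpose a b (transpose a b i) ≡ i
transpose-involutive a b a≢b = split-at-pair a b
  (trans (cong (transpose a b) (transpose-matchˡ a b)) (transpose-matchʳ a b a≢b))
  (trans (cong (transpose a b) (transpose-matchʳ a b a≢b)) (transpose-matchˡ a b))
  (λ i i≢a i≢b → trans (cong (transpose a b) (transpose-other a b i i≢a i≢b)) (transpose-other a b i i≢a i≢b))

-- Determinants

Matrix : ℕ → Set
Matrix n = Fin n → Fin n → ℤ

sign : ∀ {n} → Fin n → ℤ
sign j = (- + 1) ℤ.^ toℕ j

sign-suc : ∀ {n} (j : Fin n) → sign (suc j) ≡ - sign j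
sign-suc j = ℤP.-1*i≡-i (sign j)

minor : ∀ {n} → Matrix (suc n) → Fin (suc n) → Matrix n
minor M j i k = M (suc i) (punchIn j k)

det-cong : ∀ {n} {M N : Matrix n} → (∀ i j → M i j ≡ N i j) → det M ≡ det N
det-cong {zero}  M≗N = refl
det-cong {suc n} M≗N =
  sumℤ-cong (λ j → cong₂ (λ x y → sign j * x * y) (M≗N zero j) (det-cong (λ i k → M≗N (suc i) (punchIn j k))))

det-linear-row : ∀ {n} (k : Fin n) (M N P : Matrix n) c →
                 (∀ i j → i ≢ k → M i j ≡ P i j) → (∀ i j → i ≢ k → N i j ≡ P i j) →
                 (∀ j → P k j ≡ M k j + c * N k j) → det P ≡ det M + c * det N
det-linear-row {suc n} k M N P c M≈P N≈P Pₖ = begin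
  sumℤ (λ j → sign j * P zero j * det (minor P j)) ≡⟨ sumℤ-cong (term k M≈P N≈P Pₖ) ⟩
  sumℤ (λ j → termM j + c * termN j)                ≡⟨ sumℤ-distrib-+ termM (λ j → c * termN j) ⟩
  det M + sumℤ (λ j → c * termN j)                  ≡⟨ cong (_+_ (det M)) (*-distribˡ-sumℤ c termN) ⟨
  det M + c * det N                                 ∎
  where
  termM termN : Fin (suc n) → ℤ
  termM j = sign j * M zero j * det (minor M j)
  termN j = sign j * N zero j * det (minor N j)
  term : ∀ k → (∀ i j → i ≢ k → M i j ≡ P i j) → (∀ i j → i ≢ k → N i j ≡ P i j) →
         (∀ j → P k j ≡ M k j + c * N k j) → ∀ j → sign j * P zero j * det (minor P j) ≡ termM j + c * termN j
  term zero M≈P N≈P P₀ j = begin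
    sign j * P zero j * det (minor P j)
      ≡⟨ cong (λ x → sign j * x * det (minor P j)) (P₀ j) ⟩
    sign j * (M zero j + c * N zero j) * det (minor P j)
      ≡⟨ distrib (sign j) (M zero j) (N zero j) c (det (minor P j)) ⟩
    sign j * M zero j * det (minor P j) + c * (sign j * N zero j * det (minor P j))
      ≡⟨ cong₂ (λ x y → sign j * M zero j * x + c * (sign j * N zero j * y))
               (det-cong (λ i l → sym (M≈P (suc i) (punchIn j l) λ ())))
               (det-cong (λ i l → sym (N≈P (suc i) (punchIn j l) λ ()))) ⟩
    termM j + c * termN j                                                 ∎
    where
    distrib : ∀ s m x c d → s * (m + c * x) * d ≡ s * m * d + c * (s * x * d)
    distrib = solve-∀
  term (suc k) M≈P N≈P Pₖ j = begin
    sign j * P zero j * det (minor P j)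
      ≡⟨ cong (sign j * P zero j *_) (det-linear-row k (minor M j) (minor N j) (minor P j) c
           (λ i l i≢k → M≈P (suc i) (punchIn j l) (i≢k ∘ FinP.suc-injective))
           (λ i l i≢k → N≈P (suc i) (punchIn j l) (i≢k ∘ FinP.suc-injective))
           (λ l → Pₖ (punchIn j l))) ⟩
    sign j * P zero j * (det (minor M j) + c * det (minor N j))
      ≡⟨ distrib (sign j) (P zero j) (det (minor M j)) (det (minor N j)) c ⟩
    sign j * P zero j * det (minor M j) + c * (sign j * P zero j * det (minor N j))
      ≡⟨ cong₂ (λ x y → sign j * x * det (minor M j) + c * (sign j * y * det (minor N j)))
               (sym (M≈P zero j λ ())) (sym (N≈P zero j λ ())) ⟩
    termM j + c * termN j ∎
    where
    distrib : ∀ s p x y c → s * p * (x + c * y) ≡ s * p * x + c * (s * p * y)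
    distrib = solve-∀

-- G j k depends only on the unordered pair {j , punchIn j k}.
PairSymmetric : ∀ {m} → (Fin (suc m) → Fin m → ℤ) → Set
PairSymmetric {zero}  G = ⊤
PairSymmetric {suc m} G = (∀ k → G zero k ≡ G (suc k) zero) × PairSymmetric (λ j k → G (suc j) (suc k))

PairSymmetric-cong : ∀ {m} (G H : Fin (suc m) → Fin m → ℤ) → (∀ j k → G j k ≡ H j k) → PairSymmetric G → PairSymmetric H
PairSymmetric-cong {zero}  G H G≗H _ = tt
PairSymmetric-cong {suc m} G H G≗H (sym₀ , symₛ) =
  (λ k → trans (sym (G≗H zero k)) (trans (sym₀ k) (G≗H (suc k) zero))) ,
  PairSymmetric-cong _ _ (λ j k → G≗H (suc j) (suc k)) symₛ

-- Each pair of columns occurs twice in the double sum, with opposite signs.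
alternating-double-sum : ∀ {m} (r : Fin (suc m) → ℤ) (G : Fin (suc m) → Fin m → ℤ) → PairSymmetric G →
  sumℤ (λ j → sign j * r j * sumℤ (λ k → sign k * r (punchIn j k) * G j k)) ≡ + 0
alternating-double-sum {zero}  r G _ = cancel (r zero)
  where
  cancel : ∀ a → + 1 * a * + 0 + + 0 ≡ + 0
  cancel = solve-∀
alternating-double-sum {suc m} r G (sym₀ , symₛ) = begin
  first + sumℤ (λ j → sign (suc j) * r (suc j) * (+ 1 * r zero * G (suc j) zero + sumℤ (λ k → sign (suc k) * r′ (punchIn j k) * G′ j k)))
    ≡⟨ cong (_+_ first) (sumℤ-cong split) ⟩
  first + sumℤ (λ j → - pairs₀ j + rest j)
    ≡⟨ cong (_+_ first) (sumℤ-distrib-+ (λ j → - pairs₀ j) rest) ⟩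
  first + (sumℤ (λ j → - pairs₀ j) + sumℤ rest)
    ≡⟨ cong₂ (λ x y → first + (x + y)) (neg-sumℤ pairs₀) (sym (alternating-double-sum r′ G′ symₛ)) ⟨
  first + (- sumℤ pairs₀ + + 0)
    ≡⟨ cong (λ x → x + (- sumℤ pairs₀ + + 0)) first≡pairs₀ ⟩
  sumℤ pairs₀ + (- sumℤ pairs₀ + + 0)
    ≡⟨ cancel (sumℤ pairs₀) ⟩
  + 0 ∎
  where
  r′ : Fin (suc m) → ℤ
  r′ i = r (suc i)
  G′ : Fin (suc m) → Fin m → ℤ
  G′ j k = G (suc j) (suc k)
  first : ℤ
  first = + 1 * r zero * sumℤ (λ k → sign k * r (suc k) * G zero k)
  pairs₀ rest : Fin (suc m) → ℤ
  pairs₀ j = sign j * r′ j * r zero * G (suc j) zero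
  rest j = sign j * r′ j * sumℤ (λ k → sign k * r′ (punchIn j k) * G′ j k)
  cancel : ∀ a → a + (- a + + 0) ≡ + 0
  cancel = solve-∀
  split : ∀ j → sign (suc j) * r (suc j) * (+ 1 * r zero * G (suc j) zero + sumℤ (λ k → sign (suc k) * r′ (punchIn j k) * G′ j k))
                ≡ - pairs₀ j + rest j
  split j = begin
    sign (suc j) * r′ j * (+ 1 * r zero * G (suc j) zero + sumℤ (λ k → sign (suc k) * r′ (punchIn j k) * G′ j k))
      ≡⟨ cong₂ (λ x y → x * r′ j * (+ 1 * r zero * G (suc j) zero + y)) (sign-suc j)
               (trans (sumℤ-cong (λ k → cong (λ x → x * r′ (punchIn j k) * G′ j k) (sign-suc k)))
                      (trans (sumℤ-cong (λ k → neg-first (sign k) (r′ (punchIn j k)) (G′ j k)))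
                             (sym (neg-sumℤ (λ k → sign k * r′ (punchIn j k) * G′ j k))))) ⟩
    (- sign j) * r′ j * (+ 1 * r zero * G (suc j) zero + - sumℤ (λ k → sign k * r′ (punchIn j k) * G′ j k))
      ≡⟨ rearrange (sign j) (r′ j) (r zero) (G (suc j) zero) _ ⟩
    - pairs₀ j + rest j ∎
    where
    neg-first : ∀ s x g → (- s) * x * g ≡ - (s * x * g)
    neg-first = solve-∀
    rearrange : ∀ s rⱼ r₀ g I → (- s) * rⱼ * (+ 1 * r₀ * g + - I) ≡ - (s * rⱼ * r₀ * g) + s * rⱼ * I
    rearrange = solve-∀
  first≡pairs₀ : first ≡ sumℤ pairs₀
  first≡pairs₀ = begin
    + 1 * r zero * sumℤ (λ k → sign k * r (suc k) * G zero k)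
      ≡⟨ cong (_* sumℤ (λ k → sign k * r (suc k) * G zero k)) (ℤP.*-identityˡ (r zero)) ⟩
    r zero * sumℤ (λ k → sign k * r (suc k) * G zero k)
      ≡⟨ *-distribˡ-sumℤ (r zero) (λ k → sign k * r (suc k) * G zero k) ⟩
    sumℤ (λ k → r zero * (sign k * r (suc k) * G zero k))
      ≡⟨ sumℤ-cong (λ k → cong (λ g → r zero * (sign k * r (suc k) * g)) (sym₀ k)) ⟩
    sumℤ (λ k → r zero * (sign k * r (suc k) * G (suc k) zero))
      ≡⟨ sumℤ-cong (λ k → reorder (r zero) (sign k) (r (suc k)) (G (suc k) zero)) ⟩
    sumℤ pairs₀ ∎
    where
    reorder : ∀ a s x g → a * (s * x * g) ≡ s * x * a * g
    reorder = solve-∀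

punchIn-pair-symmetric : ∀ {n} (H : (Fin n → Fin (suc (suc n))) → ℤ) → (∀ f g → (∀ x → f x ≡ g x) → H f ≡ H g) →
                         PairSymmetric {suc n} (λ j k → H (λ x → punchIn j (punchIn k x)))
punchIn-pair-symmetric {zero}  H H-cong = (λ k → refl) , tt
punchIn-pair-symmetric {suc n} H H-cong = (λ k → refl) ,
  PairSymmetric-cong (λ j k → H (Fin.lift 1 (λ x → punchIn j (punchIn k x)))) (λ j k → H (λ x → punchIn (suc j) (punchIn (suc k) x)))
    (λ j k → H-cong _ _ (λ { zero → refl ; (suc x) → refl }))
    (punchIn-pair-symmetric (λ f → H (Fin.lift 1 f)) (λ f g f≗g → H-cong _ _ (λ { zero → refl ; (suc x) → cong suc (f≗g x) })))

det-first-rows-equal : ∀ {n} (M : Matrix (suc (suc n))) → (∀ j → M (suc zero) j ≡ M zero j) → det M ≡ + 0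
det-first-rows-equal {n} M M₁≡M₀ = trans
  (sumℤ-cong (λ j → cong (sign j * M zero j *_) (sumℤ-cong (λ k → cong (λ x → sign k * x * G j k) (M₁≡M₀ (punchIn j k))))))
  (alternating-double-sum (M zero) G
    (punchIn-pair-symmetric (λ f → det (λ i x → M (suc (suc i)) (f x))) (λ f g f≗g → det-cong (λ i x → cong (M (suc (suc i))) (f≗g x)))))
  where
  G : Fin (suc (suc n)) → Fin (suc n) → ℤ
  G j k = det (λ i x → M (suc (suc i)) (punchIn j (punchIn k x)))

Alternating : ℕ → Set
Alternating n = ∀ (M : Matrix n) {a b} → a ≢ b → (∀ j → M a j ≡ M b j) → det M ≡ + 0

-- Expand det R(Mₐ + M_b , Mₐ + M_b) = 0 by linearity in rows a and b.
alternating⇒swap-rows : ∀ {n} → Alternating n → ∀ (M : Matrix n) {a b} → a ≢ b →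
                        det (λ i → M (transpose a b i)) ≡ - det M
alternating⇒swap-rows {n} alt M {a} {b} a≢b = begin
  det (M ∘ τ)                       ≡⟨ cancel (det M) (det (M ∘ τ)) ⟩
  (det M + det (M ∘ τ)) + - det M   ≡⟨ cong (_+ - det M) expand ⟨
  + 0 + - det M                     ≡⟨ ℤP.+-identityˡ (- det M) ⟩
  - det M                           ∎
  where
  τ : Fin n → Fin n
  τ = transpose a b
  R : (Fin n → ℤ) → (Fin n → ℤ) → Matrix n
  R x y = updateAt (updateAt M a (λ _ → x)) b (λ _ → y)
  R-a : ∀ x y → R x y a ≡ x
  R-a x y = trans (updateAt-minimal a b _ a≢b) (updateAt-updates a M)
  R-b : ∀ x y → R x y b ≡ y
  R-b x y = updateAt-updates b (updateAt M a (λ _ → x))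
  R-other : ∀ x y i → i ≢ a → i ≢ b → R x y i ≡ M i
  R-other x y i i≢a i≢b = trans (updateAt-minimal i b _ i≢b) (updateAt-minimal i a M i≢a)
  R-off-a : ∀ x x′ y i → i ≢ a → R x y i ≡ R x′ y i
  R-off-a x x′ y i i≢a with i Fin.≟ b
  ... | yes refl = trans (R-b x y) (sym (R-b x′ y))
  ... | no i≢b   = trans (R-other x y i i≢a i≢b) (sym (R-other x′ y i i≢a i≢b))
  R-off-b : ∀ x y y′ i → i ≢ b → R x y i ≡ R x y′ i
  R-off-b x y y′ i i≢b with i Fin.≟ a
  ... | yes refl = trans (R-a x y) (sym (R-a x y′))
  ... | no i≢a   = trans (R-other x y i i≢a i≢b) (sym (R-other x y′ i i≢a i≢b))
  s : Fin n → ℤ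
  s j = M a j + M b j
  linear-a : ∀ y → det (R s y) ≡ det (R (M a) y) + + 1 * det (R (M b) y)
  linear-a y = det-linear-row a (R (M a) y) (R (M b) y) (R s y) (+ 1)
    (λ i j i≢a → cong-app (R-off-a _ _ y i i≢a) j) (λ i j i≢a → cong-app (R-off-a _ _ y i i≢a) j)
    (λ j → trans (cong-app (R-a s y) j)
                 (sym (trans (cong₂ (λ u v → u + + 1 * v) (cong-app (R-a (M a) y) j) (cong-app (R-a (M b) y) j))
                             (cong (_+_ (M a j)) (ℤP.*-identityˡ (M b j))))))
  linear-b : ∀ x → det (R x s) ≡ det (R x (M a)) + + 1 * det (R x (M b))
  linear-b x = det-linear-row b (R x (M a)) (R x (M b)) (R x s) (+ 1)
    (λ i j i≢b → cong-app (R-off-b x _ _ i i≢b) j) (λ i j i≢b → cong-app (R-off-b x _ _ i i≢b) j)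
    (λ j → trans (cong-app (R-b x s) j)
                 (sym (trans (cong₂ (λ u v → u + + 1 * v) (cong-app (R-b x (M a)) j) (cong-app (R-b x (M b)) j))
                             (cong (_+_ (M a j)) (ℤP.*-identityˡ (M b j))))))
  R-rows-equal : ∀ x → det (R x x) ≡ + 0
  R-rows-equal x = alt (R x x) a≢b (λ j → cong-app (trans (R-a x x) (sym (R-b x x))) j)
  R≗M : ∀ i → R (M a) (M b) i ≡ M i
  R≗M = split-at-pair a b (R-a _ _) (R-b _ _) (R-other _ _)
  R≗M∘τ : ∀ i → R (M b) (M a) i ≡ M (τ i)
  R≗M∘τ = split-at-pair a b
    (trans (R-a _ _) (cong M (sym (transpose-matchˡ a b))))
    (trans (R-b _ _) (cong M (sym (transpose-matchʳ a b a≢b))))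
    (λ i i≢a i≢b → trans (R-other _ _ i i≢a i≢b) (cong M (sym (transpose-other a b i i≢a i≢b))))
  expand : + 0 ≡ det M + det (M ∘ τ)
  expand = begin
    + 0
      ≡⟨ R-rows-equal s ⟨
    det (R s s)
      ≡⟨ linear-a s ⟩
    det (R (M a) s) + + 1 * det (R (M b) s)
      ≡⟨ cong₂ (λ u v → u + + 1 * v) (linear-b (M a)) (linear-b (M b)) ⟩
    (det (R (M a) (M a)) + + 1 * det (R (M a) (M b))) + + 1 * (det (R (M b) (M a)) + + 1 * det (R (M b) (M b)))
      ≡⟨ cong₂ (λ u v → (u + + 1 * det (R (M a) (M b))) + + 1 * (det (R (M b) (M a)) + + 1 * v)) (R-rows-equal (M a)) (R-rows-equal (M b)) ⟩
    (+ 0 + + 1 * det (R (M a) (M b))) + + 1 * (det (R (M b) (M a)) + + 1 * + 0)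
      ≡⟨ cong₂ (λ u v → (+ 0 + + 1 * u) + + 1 * (v + + 1 * + 0))
               (det-cong (λ i j → cong-app (R≗M i) j)) (det-cong (λ i j → cong-app (R≗M∘τ i) j)) ⟩
    (+ 0 + + 1 * det M) + + 1 * (det (M ∘ τ) + + 1 * + 0)
      ≡⟨ simplify (det M) (det (M ∘ τ)) ⟩
    det M + det (M ∘ τ) ∎
    where
    simplify : ∀ x y → (+ 0 + + 1 * x) + + 1 * (y + + 1 * + 0) ≡ x + y
    simplify = solve-∀
  cancel : ∀ d d′ → d′ ≡ (d + d′) + - d
  cancel = solve-∀

det-row0-equals-later : ∀ {n} → Alternating (suc n) → (M : Matrix (suc (suc n))) (b : Fin n) →
                        (∀ j → M zero j ≡ M (suc (suc b)) j) → det M ≡ + 0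
det-row0-equals-later {n} alt M b M₀≡Mᵦ = begin
  det M      ≡⟨ ℤP.neg-involutive (det M) ⟨
  - - det M  ≡⟨ cong -_ det-M′ ⟨
  - det M′   ≡⟨ cong -_ (det-first-rows-equal M′ (λ j → sym (M₀≡Mᵦ j))) ⟩
  - + 0      ∎
  where
  τ : Fin (suc n) → Fin (suc n)
  τ = transpose zero (suc b)
  -- M′ swaps rows 1 and b + 2 of M: this negates every first-row minor and makes rows 0 and 1 equal.
  M′ : Matrix (suc (suc n))
  M′ zero    = M zero
  M′ (suc i) = M (suc (τ i))
  det-M′ : det M′ ≡ - det M
  det-M′ = begin
    sumℤ (λ j → sign j * M zero j * det (λ i → minor M j (τ i)))
      ≡⟨ sumℤ-cong (λ j → cong (sign j * M zero j *_) (alternating⇒swap-rows alt (minor M j) {zero} {suc b} λ ())) ⟩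
    sumℤ (λ j → sign j * M zero j * - det (minor M j))
      ≡⟨ sumℤ-cong (λ j → sym (ℤP.neg-distribʳ-* (sign j * M zero j) (det (minor M j)))) ⟩
    sumℤ (λ j → - (sign j * M zero j * det (minor M j)))
      ≡⟨ neg-sumℤ (λ j → sign j * M zero j * det (minor M j)) ⟨
    - det M ∎

det-equal-rows : ∀ n → Alternating n
det-equal-rows (suc n) M {zero}  {zero}  0≢0 _ = contradiction refl 0≢0
det-equal-rows (suc n) M {suc a} {suc b} a≢b Mₐ≡Mᵦ =
  sumℤ-zero (λ j → sign j * M zero j * det (minor M j))
    (λ j → trans (cong (sign j * M zero j *_) (det-equal-rows n (minor M j) (a≢b ∘ cong suc) (λ k → Mₐ≡Mᵦ (punchIn j k))))
                 (ℤP.*-zeroʳ (sign j * M zero j)))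
det-equal-rows (suc (suc n)) M {zero}        {suc zero}    _ M₀≡M₁ = det-first-rows-equal M (λ j → sym (M₀≡M₁ j))
det-equal-rows (suc (suc n)) M {suc zero}    {zero}        _ M₁≡M₀ = det-first-rows-equal M M₁≡M₀
det-equal-rows (suc (suc n)) M {zero}        {suc (suc b)} _ M₀≡Mᵦ = det-row0-equals-later (det-equal-rows (suc n)) M b M₀≡Mᵦ
det-equal-rows (suc (suc n)) M {suc (suc b)} {zero}        _ Mᵦ≡M₀ =
  det-row0-equals-later (det-equal-rows (suc n)) M b (λ j → sym (Mᵦ≡M₀ j))

det-swap-rows : ∀ {n} (M : Matrix n) {a b} → a ≢ b → det (λ i → M (transpose a b i)) ≡ - det M
det-swap-rows {n} = alternating⇒swap-rows (det-equal-rows n)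

det-add-row-multiple : ∀ {n} (M P : Matrix n) {k l} c → k ≢ l →
                       (∀ i j → i ≢ k → P i j ≡ M i j) → (∀ j → P k j ≡ M k j + c * M l j) → det P ≡ det M
det-add-row-multiple {n} M P {k} {l} c k≢l P≈M Pₖ = begin
  det P              ≡⟨ det-linear-row k M N P c (λ i j i≢k → sym (P≈M i j i≢k)) N≈P Pₖ′ ⟩
  det M + c * det N  ≡⟨ cong (λ x → det M + c * x) (det-equal-rows n N k≢l (λ j → cong-app (trans Nₖ (sym Nₗ)) j)) ⟩
  det M + c * + 0    ≡⟨ cong (_+_ (det M)) (ℤP.*-zeroʳ c) ⟩
  det M + + 0        ≡⟨ ℤP.+-identityʳ (det M) ⟩
  det M              ∎
  where
  N : Matrix n
  N = updateAt M k (λ _ → M l)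
  Nₖ : N k ≡ M l
  Nₖ = updateAt-updates k M
  Nₗ : N l ≡ M l
  Nₗ = updateAt-minimal l k M (k≢l ∘ sym)
  N≈P : ∀ i j → i ≢ k → N i j ≡ P i j
  N≈P i j i≢k = trans (cong-app (updateAt-minimal i k M i≢k) j) (sym (P≈M i j i≢k))
  Pₖ′ : ∀ j → P k j ≡ M k j + c * N k j
  Pₖ′ j = trans (Pₖ j) (cong (λ x → M k j + c * x) (sym (cong-app Nₖ j)))

det-add-multiples-of-row : ∀ {n} (M : Matrix n) s (c : Fin n → ℤ) → c s ≡ + 0 →
                           det (λ i j → M i j + c i * M s j) ≡ det M
det-add-multiples-of-row {n} M s c cₛ≡0 = go n c cₛ≡0 (λ i n≤i → contradiction (FinP.toℕ<n i) (ℕP.≤⇒≯ n≤i))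
  where
  add : (Fin n → ℤ) → Matrix n
  add c i j = M i j + c i * M s j
  add-zero : ∀ c i j → c i ≡ + 0 → add c i j ≡ M i j
  add-zero c i j cᵢ≡0 = trans (cong (λ x → M i j + x * M s j) cᵢ≡0) (ℤP.+-identityʳ (M i j))
  go : ∀ t c → c s ≡ + 0 → (∀ i → t ≤ toℕ i → c i ≡ + 0) → det (add c) ≡ det M
  go zero    c _     c≡0 = det-cong (λ i j → add-zero c i j (c≡0 i ℕ.z≤n))
  go (suc t) c cₛ≡0 c≡0 with t ℕ.<? n
  ... | no t≮n = go t c cₛ≡0 (λ i t≤i → contradiction (ℕP.≤-<-trans t≤i (FinP.toℕ<n i)) t≮n)
  ... | yes t<n = trans step (go t c′ c′ₛ≡0 c′≡0)
    where
    f : Fin n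
    f = Fin.fromℕ< t<n
    c′ : Fin n → ℤ
    c′ = updateAt c f (λ _ → + 0)
    c′f≡0 : c′ f ≡ + 0
    c′f≡0 = updateAt-updates f c
    c′≡c : ∀ i → i ≢ f → c′ i ≡ c i
    c′≡c i i≢f = updateAt-minimal i f c i≢f
    c′ₛ≡0 : c′ s ≡ + 0
    c′ₛ≡0 with s Fin.≟ f
    ... | yes refl = c′f≡0
    ... | no s≢f   = trans (c′≡c s s≢f) cₛ≡0
    c′≡0 : ∀ i → t ≤ toℕ i → c′ i ≡ + 0
    c′≡0 i t≤i with i Fin.≟ f
    ... | yes refl = c′f≡0
    ... | no i≢f   = trans (c′≡c i i≢f)
                           (c≡0 i (ℕP.≤∧≢⇒< t≤i (λ t≡i → i≢f (FinP.toℕ-injective (trans (sym t≡i) (sym (FinP.toℕ-fromℕ< t<n)))))))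
    step : det (add c) ≡ det (add c′)
    step with f Fin.≟ s
    ... | yes refl = det-cong (λ i j → cases i j (i Fin.≟ f))
      where
      cases : ∀ i j → Dec (i ≡ f) → add c i j ≡ add c′ i j
      cases i j (yes refl) = trans (add-zero c i j cₛ≡0) (sym (add-zero c′ i j c′f≡0))
      cases i j (no i≢f)   = cong (λ x → M i j + x * M f j) (sym (c′≡c i i≢f))
    ... | no f≢s = det-add-row-multiple (add c′) (add c) (c f) f≢s
      (λ i j i≢f → cong (λ x → M i j + x * M s j) (sym (c′≡c i i≢f)))
      (λ j → sym (cong₂ (λ x y → x + c f * y) (add-zero c′ f j c′f≡0) (add-zero c′ s j c′ₛ≡0)))

det-expand-column : ∀ {n} (M : Matrix (suc n)) →
                    det M ≡ sumℤ (λ i → sign i * M i zero * det (λ a b → M (punchIn i a) (suc b)))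
det-expand-column {zero}  M = refl
det-expand-column {suc n} M = cong (_+_ (sign {suc (suc n)} zero * M zero zero * det (minor M zero))) (begin
  sumℤ (λ j → sign (suc j) * M zero (suc j) * det (minor M (suc j)))
    ≡⟨ sumℤ-cong (λ j → cong (sign (suc j) * M zero (suc j) *_) (det-expand-column (minor M (suc j)))) ⟩
  sumℤ (λ j → sign (suc j) * M zero (suc j) * sumℤ (λ i → sign i * M (suc i) zero * D i j))
    ≡⟨ sumℤ-cong (λ j → *-distribˡ-sumℤ (sign (suc j) * M zero (suc j)) (λ i → sign i * M (suc i) zero * D i j)) ⟩
  sumℤ (λ j → sumℤ (λ i → sign (suc j) * M zero (suc j) * (sign i * M (suc i) zero * D i j)))
    ≡⟨ sumℤ-comm (λ j i → sign (suc j) * M zero (suc j) * (sign i * M (suc i) zero * D i j)) ⟩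
  sumℤ (λ i → sumℤ (λ j → sign (suc j) * M zero (suc j) * (sign i * M (suc i) zero * D i j)))
    ≡⟨ sumℤ-cong (λ i → sumℤ-cong (λ j → swap-factors i j)) ⟩
  sumℤ (λ i → sumℤ (λ j → sign (suc i) * M (suc i) zero * (sign j * M zero (suc j) * D i j)))
    ≡⟨ sumℤ-cong (λ i → *-distribˡ-sumℤ (sign (suc i) * M (suc i) zero) (λ j → sign j * M zero (suc j) * D i j)) ⟨
  sumℤ (λ i → sign (suc i) * M (suc i) zero * sumℤ (λ j → sign j * M zero (suc j) * D i j)) ∎)
  where
  D : Fin (suc n) → Fin (suc n) → ℤ
  D i j = det (λ a b → M (suc (punchIn i a)) (suc (punchIn j b)))
  swap-factors : ∀ i j → sign (suc j) * M zero (suc j) * (sign i * M (suc i) zero * D i j)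
                       ≡ sign (suc i) * M (suc i) zero * (sign j * M zero (suc j) * D i j)
  swap-factors i j = begin
    sign (suc j) * M zero (suc j) * (sign i * M (suc i) zero * D i j)
      ≡⟨ cong (λ s → s * M zero (suc j) * (sign i * M (suc i) zero * D i j)) (sign-suc j) ⟩
    - sign j * M zero (suc j) * (sign i * M (suc i) zero * D i j)
      ≡⟨ reorder (sign j) (sign i) (M zero (suc j)) (M (suc i) zero) (D i j) ⟩
    - sign i * M (suc i) zero * (sign j * M zero (suc j) * D i j)
      ≡⟨ cong (λ s → s * M (suc i) zero * (sign j * M zero (suc j) * D i j)) (sign-suc i) ⟨
    sign (suc i) * M (suc i) zero * (sign j * M zero (suc j) * D i j) ∎
    where
    reorder : ∀ sⱼ sᵢ x y d → (- sⱼ) * x * (sᵢ * y * d) ≡ (- sᵢ) * y * (sⱼ * x * d)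
    reorder = solve-∀

det-transpose : ∀ {n} (M : Matrix n) → det (λ i j → M j i) ≡ det M
det-transpose {zero}  M = refl
det-transpose {suc n} M = trans
  (sumℤ-cong (λ j → cong (sign j * M j zero *_) (det-transpose (λ a b → M (punchIn j a) (suc b)))))
  (sym (det-expand-column M))

det-swap-columns : ∀ {n} (M : Matrix n) {a b} → a ≢ b → det (λ i j → M i (transpose a b j)) ≡ - det M
det-swap-columns M {a} {b} a≢b = begin
  det (λ i j → M i (transpose a b j))  ≡⟨ det-transpose (λ i j → M i (transpose a b j)) ⟨
  det (λ i j → M j (transpose a b i))  ≡⟨ det-swap-rows (λ i j → M j i) a≢b ⟩
  - det (λ i j → M j i)                ≡⟨ cong -_ (det-transpose M) ⟩
  - det M                              ∎

det-conjugate-transpose : ∀ {n} (M : Matrix n) {a b} → a ≢ b →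
                          det (λ i j → M (transpose a b i) (transpose a b j)) ≡ det M
det-conjugate-transpose M {a} {b} a≢b = begin
  det (λ i j → M (transpose a b i) (transpose a b j))  ≡⟨ det-swap-columns (λ i → M (transpose a b i)) a≢b ⟩
  - det (λ i → M (transpose a b i))                    ≡⟨ cong -_ (det-swap-rows M a≢b) ⟩
  - - det M                                            ≡⟨ ℤP.neg-involutive (det M) ⟩
  det M                                                ∎

-- Determinants modulo 4

[**]₄ : ∀ x y z → [ x * y * z ]₄ ≡ [ x ]₄ *₄ [ y ]₄ *₄ [ z ]₄
[**]₄ x y z = [⟦⟧]₄ (var zero :* var (suc zero) :* var (suc (suc zero))) (x ∷ y ∷ z ∷ [])

[**]₄-middle-zero : ∀ x y z → [ y ]₄ ≡ 0₄ → [ x * y * z ]₄ ≡ 0₄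
[**]₄-middle-zero x y z y≡0 = begin
  [ x * y * z ]₄              ≡⟨ [**]₄ x y z ⟩
  [ x ]₄ *₄ [ y ]₄ *₄ [ z ]₄  ≡⟨ cong (λ a → [ x ]₄ *₄ a *₄ [ z ]₄) y≡0 ⟩
  [ x ]₄ *₄ 0₄ *₄ [ z ]₄      ≡⟨ from-yes (∀₄? λ a → ∀₄? λ b → a *₄ 0₄ *₄ b ≟₄ 0₄) [ x ]₄ [ z ]₄ ⟩
  0₄                          ∎

[det]₄-pivot₁ : ∀ {n} (M : Matrix (suc n)) → (∀ i → [ M (suc i) zero ]₄ ≡ 0₄) →
                [ det M ]₄ ≡ [ M zero zero ]₄ *₄ [ det (λ i k → M (suc i) (suc k)) ]₄
[det]₄-pivot₁ {n} M col≡0 = begin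
  [ det M ]₄                                       ≡⟨ cong [_]₄ (det-expand-column M) ⟩
  [ + 1 * M zero zero * det L + rest ]₄            ≡⟨ [+]₄ (+ 1 * M zero zero * det L) rest ⟩
  [ + 1 * M zero zero * det L ]₄ +₄ [ rest ]₄      ≡⟨ cong₂ _+₄_ ([**]₄ (+ 1) (M zero zero) (det L))
                                                        ([sumℤ]₄≡0₄ rest-term (λ i → [**]₄-middle-zero (sign (suc i)) _ _ (col≡0 i))) ⟩
  [ M zero zero ]₄ *₄ [ det L ]₄ +₄ 0₄             ≡⟨ +₄-identityʳ _ ⟩
  [ M zero zero ]₄ *₄ [ det L ]₄                   ∎
  where
  L : Matrix n
  L i k = M (suc i) (suc k)
  rest-term : Fin n → ℤ
  rest-term i = sign (suc i) * M (suc i) zero * det (λ a b → M (punchIn (suc i) a) (suc b))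
  rest : ℤ
  rest = sumℤ rest-term

[det]₄-pivot₂ : ∀ {n} (M : Matrix (suc (suc n))) →
                (∀ i → [ M (suc (suc i)) zero ]₄ ≡ 0₄) → (∀ i → [ M (suc (suc i)) (suc zero) ]₄ ≡ 0₄) →
                [ det M ]₄ ≡ [ M zero zero * M (suc zero) (suc zero) - M (suc zero) zero * M zero (suc zero) ]₄
                               *₄ [ det (λ i k → M (suc (suc i)) (suc (suc k))) ]₄
[det]₄-pivot₂ {n} M col₀≡0 col₁≡0 = begin
  [ det M ]₄
    ≡⟨ cong [_]₄ (det-expand-column M) ⟩
  [ + 1 * a * det N₀ + (- + 1 * c * det N₁ + rest) ]₄
    ≡⟨ [⟦⟧]₄ (var 0F :* var 1F :* var 2F :+ (:- var 0F :* var 3F :* var 4F :+ var 5F))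
                                                                                      (+ 1 ∷ a ∷ det N₀ ∷ c ∷ det N₁ ∷ rest ∷ []) ⟩
  1₄ *₄ [ a ]₄ *₄ [ det N₀ ]₄ +₄ (-₄ 1₄ *₄ [ c ]₄ *₄ [ det N₁ ]₄ +₄ [ rest ]₄)
    ≡⟨ cong₂ (λ x y → 1₄ *₄ [ a ]₄ *₄ x +₄ y) ([det]₄-pivot₁ N₀ col₁≡0)
             (cong₂ (λ x y → -₄ 1₄ *₄ [ c ]₄ *₄ x +₄ y) ([det]₄-pivot₁ N₁ col₁≡0)
                    ([sumℤ]₄≡0₄ rest-term (λ i → [**]₄-middle-zero (sign (suc (suc i))) _ _ (col₀≡0 i)))) ⟩
  1₄ *₄ [ a ]₄ *₄ ([ d ]₄ *₄ [ det L ]₄) +₄ (-₄ 1₄ *₄ [ c ]₄ *₄ ([ b ]₄ *₄ [ det L ]₄) +₄ 0₄)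
    ≡⟨ collect [ a ]₄ [ b ]₄ [ c ]₄ [ d ]₄ [ det L ]₄ ⟩
  ([ a ]₄ *₄ [ d ]₄ +₄ -₄ ([ c ]₄ *₄ [ b ]₄)) *₄ [ det L ]₄
    ≡⟨ cong (_*₄ [ det L ]₄) ([⟦⟧]₄ (var 0F :* var 1F :+ :- (var 2F :* var 3F)) (a ∷ d ∷ c ∷ b ∷ [])) ⟨
  [ a * d - c * b ]₄ *₄ [ det L ]₄ ∎
  where
  a b c d : ℤ
  a = M zero zero
  b = M zero (suc zero)
  c = M (suc zero) zero
  d = M (suc zero) (suc zero)
  N₀ N₁ : Matrix (suc n)
  N₀ i k = M (suc i) (suc k)
  N₁ i k = M (punchIn (suc zero) i) (suc k)
  L : Matrix n
  L i k = M (suc (suc i)) (suc (suc k))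
  rest-term : Fin n → ℤ
  rest-term i = sign (suc (suc i)) * M (suc (suc i)) zero * det (λ x y → M (punchIn (suc (suc i)) x) (suc y))
  rest : ℤ
  rest = sumℤ rest-term
  collect : ∀ a b c d l → 1₄ *₄ a *₄ (d *₄ l) +₄ (-₄ 1₄ *₄ c *₄ (b *₄ l) +₄ 0₄) ≡ (a *₄ d +₄ -₄ (c *₄ b)) *₄ l
  collect = from-yes (∀₄? λ a → ∀₄? λ b → ∀₄? λ c → ∀₄? λ d → ∀₄? λ l →
    1₄ *₄ a *₄ (d *₄ l) +₄ (-₄ 1₄ *₄ c *₄ (b *₄ l) +₄ 0₄) ≟₄ (a *₄ d +₄ -₄ (c *₄ b)) *₄ l)

parity-det-first-row-even : ∀ {n} (M : Matrix (suc n)) → (∀ j → parity (M zero j) ≡ false) → parity (det M) ≡ false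
parity-det-first-row-even M row-even = parity-sumℤ-even (λ j → sign j * M zero j * det (minor M j)) (λ j → begin
  parity (sign j * M zero j * det (minor M j))
    ≡⟨ parity⟦⟧ (var 0F :* var 1F :* var 2F) (sign j ∷ M zero j ∷ det (minor M j) ∷ []) ⟩
  (parity (sign j) ∧ parity (M zero j)) ∧ parity (det (minor M j))
    ≡⟨ cong (λ p → (parity (sign j) ∧ p) ∧ parity (det (minor M j))) (row-even j) ⟩
  (parity (sign j) ∧ false) ∧ parity (det (minor M j))
    ≡⟨ cong (_∧ parity (det (minor M j))) (𝔹.∧-zeroʳ (parity (sign j))) ⟩
  false ∎)

[det]₄-two-rows-even : ∀ {n} (M : Matrix (suc (suc n))) →
                       (∀ j → parity (M zero j) ≡ false) → (∀ j → parity (M (suc zero) j) ≡ false) → [ det M ]₄ ≡ 0₄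
[det]₄-two-rows-even M row₀-even row₁-even = [sumℤ]₄≡0₄ (λ j → sign j * M zero j * det (minor M j)) (λ j → begin
  [ sign j * M zero j * det (minor M j) ]₄
    ≡⟨ [**]₄ (sign j) (M zero j) (det (minor M j)) ⟩
  [ sign j ]₄ *₄ [ M zero j ]₄ *₄ [ det (minor M j) ]₄
    ≡⟨ even*even [ sign j ]₄ (row₀-even j) (parity-det-first-row-even (minor M j) (λ k → row₁-even (punchIn j k))) ⟩
  0₄ ∎)
  where
  even*even : ∀ s {x y} → odd₄ x ≡ false → odd₄ y ≡ false → s *₄ x *₄ y ≡ 0₄
  even*even s {x} {y} = from-yes (∀₄? λ s → ∀₄? λ x → ∀₄? λ y → (odd₄ x 𝔹.≟ false) →-dec (odd₄ y 𝔹.≟ false) →-dec (s *₄ x *₄ y ≟₄ 0₄)) s x y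

-- Symmetric matrices with a characteristic vector

Symmetric : ∀ {n} → Matrix n → Set
Symmetric B = ∀ i j → B i j ≡ B j i

infix 7 _∙_ _·ᵥ_

_∙_ : ∀ {n} → (Fin n → ℤ) → (Fin n → ℤ) → ℤ
u ∙ v = sumℤ (λ i → u i * v i)

_·ᵥ_ : ∀ {n} → Matrix n → (Fin n → ℤ) → Fin n → ℤ
(B ·ᵥ w) i = B i ∙ w

quadratic : ∀ {n} → Matrix n → (Fin n → ℤ) → ℤ
quadratic B w = w ∙ (B ·ᵥ w)

∙-comm : ∀ {n} (u v : Fin n → ℤ) → u ∙ v ≡ v ∙ u
∙-comm u v = sumℤ-cong (λ i → ℤP.*-comm (u i) (v i))

∙-congʳ : ∀ {n} (u : Fin n → ℤ) {v v′ : Fin n → ℤ} → (∀ i → v i ≡ v′ i) → u ∙ v ≡ u ∙ v′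
∙-congʳ u v≗v′ = sumℤ-cong (λ i → cong (u i *_) (v≗v′ i))

∙-linearʳ : ∀ {n} (u v y : Fin n → ℤ) c → u ∙ (λ i → v i + c * y i) ≡ u ∙ v + c * (u ∙ y)
∙-linearʳ u v y c = begin
  u ∙ (λ i → v i + c * y i)                 ≡⟨ sumℤ-cong (λ i → distrib (u i) (v i) c (y i)) ⟩
  sumℤ (λ i → u i * v i + c * (u i * y i))  ≡⟨ sumℤ-distrib-+ (λ i → u i * v i) (λ i → c * (u i * y i)) ⟩
  u ∙ v + sumℤ (λ i → c * (u i * y i))      ≡⟨ cong (_+_ (u ∙ v)) (*-distribˡ-sumℤ c (λ i → u i * y i)) ⟨
  u ∙ v + c * (u ∙ y)                       ∎
  where
  distrib : ∀ u v c y → u * (v + c * y) ≡ u * v + c * (u * y)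
  distrib = solve-∀

∙-linearˡ : ∀ {n} (u y v : Fin n → ℤ) c → (λ i → u i + c * y i) ∙ v ≡ u ∙ v + c * (y ∙ v)
∙-linearˡ u y v c = begin
  (λ i → u i + c * y i) ∙ v  ≡⟨ ∙-comm (λ i → u i + c * y i) v ⟩
  v ∙ (λ i → u i + c * y i)  ≡⟨ ∙-linearʳ v u y c ⟩
  v ∙ u + c * (v ∙ y)        ≡⟨ cong₂ (λ s t → s + c * t) (∙-comm v u) (∙-comm v y) ⟩
  u ∙ v + c * (y ∙ v)        ∎

∙-distrib-+ʳ : ∀ {n} (u v y : Fin n → ℤ) → u ∙ (λ i → v i + y i) ≡ u ∙ v + u ∙ y
∙-distrib-+ʳ u v y = trans (sumℤ-cong (λ i → ℤP.*-distribˡ-+ (u i) (v i) (y i)))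
                           (sumℤ-distrib-+ (λ i → u i * v i) (λ i → u i * y i))

∙-bilinearʳ : ∀ {n} (u y y′ : Fin n → ℤ) c c′ → u ∙ (λ i → c * y i + c′ * y′ i) ≡ c * (u ∙ y) + c′ * (u ∙ y′)
∙-bilinearʳ u y y′ c c′ = begin
  u ∙ (λ i → c * y i + c′ * y′ i)
    ≡⟨ sumℤ-cong (λ i → distrib (u i) c (y i) c′ (y′ i)) ⟩
  sumℤ (λ i → c * (u i * y i) + c′ * (u i * y′ i))
    ≡⟨ sumℤ-distrib-+ (λ i → c * (u i * y i)) (λ i → c′ * (u i * y′ i)) ⟩
  sumℤ (λ i → c * (u i * y i)) + sumℤ (λ i → c′ * (u i * y′ i))
    ≡⟨ cong₂ _+_ (*-distribˡ-sumℤ c (λ i → u i * y i)) (*-distribˡ-sumℤ c′ (λ i → u i * y′ i)) ⟨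
  c * (u ∙ y) + c′ * (u ∙ y′) ∎
  where
  distrib : ∀ u c y c′ y′ → u * (c * y + c′ * y′) ≡ c * (u * y) + c′ * (u * y′)
  distrib = solve-∀

Characteristic : ∀ {n} → Matrix n → (Fin n → ℤ) → Set
Characteristic B w = ∀ i → parity (B i i) ≡ parity ((B ·ᵥ w) i)

-- Equivalently: D ≡ 1 + Q - m if D is odd, and Q - m is odd if D ≡ 2.
DetRelation : ℤ₄ → ℤ₄ → ℤ₄ → Set
DetRelation m D Q = D *₄ D ≡ D *₄ (1₄ +₄ Q +₄ -₄ m)

DetRelation? : ∀ m D Q → Dec (DetRelation m D Q)
DetRelation? m D Q = D *₄ D ≟₄ D *₄ (1₄ +₄ Q +₄ -₄ m)

Odd₄ : ℤ₄ → Set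
Odd₄ x = odd₄ x ≡ true

Odd₄? : ∀ x → Dec (Odd₄ x)
Odd₄? x = odd₄ x 𝔹.≟ true

-- The relation for an orthogonal sum of two blocks, one of odd determinant.
DetRelation-⊕ : ∀ p Dₚ Qₚ m D Q → Odd₄ Dₚ → DetRelation p Dₚ Qₚ → DetRelation m D Q →
                DetRelation (p +₄ m) (Dₚ *₄ D) (Qₚ +₄ Q)
DetRelation-⊕ = from-yes (∀₄? λ p → ∀₄? λ Dₚ → ∀₄? λ Qₚ → ∀₄? λ m → ∀₄? λ D → ∀₄? λ Q →
  Odd₄? Dₚ →-dec DetRelation? p Dₚ Qₚ →-dec DetRelation? m D Q →-dec DetRelation? (p +₄ m) (Dₚ *₄ D) (Qₚ +₄ Q))

DetRelation-1×1 : ∀ b w → odd₄ b ≡ odd₄ (b *₄ w) → DetRelation 1₄ b (w *₄ (b *₄ w))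
DetRelation-1×1 = from-yes (∀₄? λ b → ∀₄? λ w → (odd₄ b 𝔹.≟ odd₄ (b *₄ w)) →-dec DetRelation? 1₄ b (w *₄ (b *₄ w)))

DetRelation-self⇒0or1 : ∀ m D → DetRelation m D m → D ≡ 0₄ ⊎ D ≡ 1₄
DetRelation-self⇒0or1 = from-yes (∀₄? λ m → ∀₄? λ D → DetRelation? m D m →-dec ((D ≟₄ 0₄) ⊎-dec (D ≟₄ 1₄)))

CharacteristicDetRelation : ℕ → Set
CharacteristicDetRelation n = ∀ (B : Matrix n) w → Symmetric B → Characteristic B w →
                              DetRelation [ n ]ℕ₄ [ det B ]₄ [ quadratic B w ]₄

-- a² ≡ 1 (mod 8) for odd a, so a is its own inverse mod 4.
pivot₁-clears : ∀ a x → Odd₄ a → x +₄ -₄ (a *₄ x) *₄ a ≡ 0₄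
pivot₁-clears = from-yes (∀₄? λ a → ∀₄? λ x → Odd₄? a →-dec (x +₄ -₄ (a *₄ x) *₄ a ≟₄ 0₄))

pivot₁-block : ∀ a w₀ β → Odd₄ a → odd₄ a ≡ odd₄ (a *₄ w₀ +₄ β) →
               DetRelation 1₄ a (w₀ *₄ (a *₄ w₀ +₄ β) +₄ w₀ *₄ β +₄ a *₄ β *₄ β)
pivot₁-block = from-yes (∀₄? λ a → ∀₄? λ w₀ → ∀₄? λ β → Odd₄? a →-dec (odd₄ a 𝔹.≟ odd₄ (a *₄ w₀ +₄ β)) →-dec
  DetRelation? 1₄ a (w₀ *₄ (a *₄ w₀ +₄ β) +₄ w₀ *₄ β +₄ a *₄ β *₄ β))

pivot₁-characteristic : ∀ a w₀ β x cᵢᵢ cvᵢ → a ≡ true → a ≡ (a ∧ w₀) xor β → cᵢᵢ ≡ (x ∧ w₀) xor cvᵢ →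
                        cᵢᵢ xor ((a ∧ x) ∧ x) ≡ cvᵢ xor ((a ∧ x) ∧ β)
pivot₁-characteristic = from-yes (∀𝔹? λ a → ∀𝔹? λ w₀ → ∀𝔹? λ β → ∀𝔹? λ x → ∀𝔹? λ cᵢᵢ → ∀𝔹? λ cvᵢ →
  (a 𝔹.≟ true) →-dec (a 𝔹.≟ (a ∧ w₀) xor β) →-dec (cᵢᵢ 𝔹.≟ (x ∧ w₀) xor cvᵢ) →-dec
  (cᵢᵢ xor ((a ∧ x) ∧ x) 𝔹.≟ cvᵢ xor ((a ∧ x) ∧ β)))

module Pivot₁ {n} (B : Matrix (suc n)) (w : Fin (suc n) → ℤ) (B-sym : Symmetric B) (w-char : Characteristic B w)
              (a-odd : parity (B zero zero) ≡ true) where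

  a w₀ : ℤ
  a  = B zero zero
  w₀ = w zero

  r v : Fin n → ℤ
  r k = B zero (suc k)
  v k = w (suc k)

  C : Matrix n
  C i k = B (suc i) (suc k)

  β : ℤ
  β = r ∙ v

  column≡row : ∀ i → B (suc i) zero ≡ r i
  column≡row i = B-sym (suc i) zero

  coeff : Fin (suc n) → ℤ
  coeff zero    = + 0
  coeff (suc i) = - (a * r i)

  P : Matrix (suc n)
  P i j = B i j + coeff i * B zero j

  S : Matrix n
  S i k = P (suc i) (suc k)

  column-cleared : ∀ i → [ P (suc i) zero ]₄ ≡ 0₄
  column-cleared i = begin
    [ B (suc i) zero + - (a * r i) * a ]₄     ≡⟨ cong (λ y → [ y + - (a * r i) * a ]₄) (column≡row i) ⟩
    [ r i + - (a * r i) * a ]₄                ≡⟨ [⟦⟧]₄ (var 1F :+ :- (var 0F :* var 1F) :* var 0F) (a ∷ r i ∷ []) ⟩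
    [ r i ]₄ +₄ -₄ ([ a ]₄ *₄ [ r i ]₄) *₄ [ a ]₄  ≡⟨ pivot₁-clears [ a ]₄ [ r i ]₄ a-odd ⟩
    0₄                                        ∎

  det-factor : [ det B ]₄ ≡ [ a ]₄ *₄ [ det S ]₄
  det-factor = begin
    [ det B ]₄                      ≡⟨ cong [_]₄ (det-add-multiples-of-row B zero coeff refl) ⟨
    [ det P ]₄                      ≡⟨ [det]₄-pivot₁ P column-cleared ⟩
    [ a + + 0 ]₄ *₄ [ det S ]₄      ≡⟨ cong (λ y → [ y ]₄ *₄ [ det S ]₄) (ℤP.+-identityʳ a) ⟩
    [ a ]₄ *₄ [ det S ]₄            ∎

  S-symmetric : Symmetric S
  S-symmetric i k = cong₂ _+_ (B-sym (suc i) (suc k)) (swap (a) (r i) (r k))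
    where
    swap : ∀ a x y → - (a * x) * y ≡ - (a * y) * x
    swap = solve-∀

  S·v : ∀ i → (S ·ᵥ v) i ≡ (C ·ᵥ v) i + - (a * r i) * β
  S·v i = ∙-linearˡ (C i) r v (- (a * r i))

  S-characteristic : Characteristic S v
  S-characteristic i = begin
    parity (C i i + - (a * r i) * r i)
      ≡⟨ parity⟦⟧ (var 4F :+ :- (var 0F :* var 3F) :* var 3F) ρ ⟩
    parity (C i i) xor ((parity a ∧ parity (r i)) ∧ parity (r i))
      ≡⟨ pivot₁-characteristic (parity a) (parity w₀) (parity β) (parity (r i)) (parity (C i i)) (parity ((C ·ᵥ v) i))
           a-odd
           (trans (w-char zero) (parity⟦⟧ (var 0F :* var 1F :+ var 2F) ρ))
           (trans (w-char (suc i)) (trans (cong (λ y → parity (y * w₀ + (C ·ᵥ v) i)) (column≡row i))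
                                          (parity⟦⟧ (var 3F :* var 1F :+ var 5F) ρ))) ⟩
    parity ((C ·ᵥ v) i) xor ((parity a ∧ parity (r i)) ∧ parity β)
      ≡⟨ parity⟦⟧ (var 5F :+ :- (var 0F :* var 3F) :* var 2F) ρ ⟨
    parity ((C ·ᵥ v) i + - (a * r i) * β)
      ≡⟨ cong parity (S·v i) ⟨
    parity ((S ·ᵥ v) i) ∎
    where
    ρ : Vector ℤ 6
    ρ = a ∷ w₀ ∷ β ∷ r i ∷ C i i ∷ (C ·ᵥ v) i ∷ []

  quadratic-B : quadratic B w ≡ w₀ * (a * w₀ + β) + (quadratic C v + w₀ * β)
  quadratic-B = cong (_+_ (w₀ * (a * w₀ + β))) (begin
    v ∙ (λ i → B (suc i) zero * w₀ + (C ·ᵥ v) i)  ≡⟨ ∙-congʳ v reorder ⟩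
    v ∙ (λ i → (C ·ᵥ v) i + w₀ * r i)            ≡⟨ ∙-linearʳ v (C ·ᵥ v) r w₀ ⟩
    quadratic C v + w₀ * (v ∙ r)                   ≡⟨ cong (λ y → quadratic C v + w₀ * y) (∙-comm v r) ⟩
    quadratic C v + w₀ * β                         ∎)
    where
    reorder : ∀ i → B (suc i) zero * w₀ + (C ·ᵥ v) i ≡ (C ·ᵥ v) i + w₀ * r i
    reorder i = begin
      B (suc i) zero * w₀ + (C ·ᵥ v) i  ≡⟨ cong (λ y → y * w₀ + (C ·ᵥ v) i) (column≡row i) ⟩
      r i * w₀ + (C ·ᵥ v) i             ≡⟨ ℤP.+-comm (r i * w₀) ((C ·ᵥ v) i) ⟩
      (C ·ᵥ v) i + r i * w₀             ≡⟨ cong (_+_ ((C ·ᵥ v) i)) (ℤP.*-comm (r i) w₀) ⟩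
      (C ·ᵥ v) i + w₀ * r i             ∎

  quadratic-S : quadratic S v ≡ quadratic C v + - (a * β) * β
  quadratic-S = begin
    v ∙ (S ·ᵥ v)                                   ≡⟨ ∙-congʳ v (λ i → trans (S·v i) (cong (_+_ ((C ·ᵥ v) i)) (swap a (r i) β))) ⟩
    v ∙ (λ i → (C ·ᵥ v) i + - (a * β) * r i)      ≡⟨ ∙-linearʳ v (C ·ᵥ v) r (- (a * β)) ⟩
    quadratic C v + - (a * β) * (v ∙ r)            ≡⟨ cong (λ y → quadratic C v + - (a * β) * y) (∙-comm v r) ⟩
    quadratic C v + - (a * β) * β                  ∎
    where
    swap : ∀ a x y → - (a * x) * y ≡ - (a * y) * x
    swap = solve-∀

  quadratic-split : quadratic B w ≡ (w₀ * (a * w₀ + β) + w₀ * β + a * β * β) + quadratic S v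
  quadratic-split = begin
    quadratic B w
      ≡⟨ quadratic-B ⟩
    w₀ * (a * w₀ + β) + (quadratic C v + w₀ * β)
      ≡⟨ regroup w₀ a β (quadratic C v) ⟩
    (w₀ * (a * w₀ + β) + w₀ * β + a * β * β) + (quadratic C v + - (a * β) * β)
      ≡⟨ cong (_+_ (w₀ * (a * w₀ + β) + w₀ * β + a * β * β)) quadratic-S ⟨
    (w₀ * (a * w₀ + β) + w₀ * β + a * β * β) + quadratic S v ∎
    where
    regroup : ∀ w₀ a β q → w₀ * (a * w₀ + β) + (q + w₀ * β) ≡ (w₀ * (a * w₀ + β) + w₀ * β + a * β * β) + (q + - (a * β) * β)
    regroup = solve-∀

  relation : CharacteristicDetRelation n → DetRelation [ suc n ]ℕ₄ [ det B ]₄ [ quadratic B w ]₄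
  relation IH = subst₂ (DetRelation (1₄ +₄ [ n ]ℕ₄)) (sym det-factor) (sym [quadratic-split]₄)
    (DetRelation-⊕ 1₄ [ a ]₄ block [ n ]ℕ₄ [ det S ]₄ [ quadratic S v ]₄ a-odd
      (pivot₁-block [ a ]₄ [ w₀ ]₄ [ β ]₄ a-odd (trans (w-char zero) (cong odd₄ ([⟦⟧]₄ (var 0F :* var 1F :+ var 2F) ρ))))
      (IH S v S-symmetric S-characteristic))
    where
    ρ : Vector ℤ 3
    ρ = a ∷ w₀ ∷ β ∷ []
    block-expr : Expr 3
    block-expr = var 1F :* (var 0F :* var 1F :+ var 2F) :+ var 1F :* var 2F :+ var 0F :* var 2F :* var 2F
    block : ℤ₄
    block = ⟦ block-expr ⟧₄ (λ i → [ ρ i ]₄)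
    [quadratic-split]₄ : [ quadratic B w ]₄ ≡ block +₄ [ quadratic S v ]₄
    [quadratic-split]₄ = trans (cong [_]₄ quadratic-split)
                               (trans ([+]₄ (⟦ block-expr ⟧ ρ) (quadratic S v)) (cong (_+₄ [ quadratic S v ]₄) ([⟦⟧]₄ block-expr ρ)))

det₂ : ∀ {k} (b₀₀ b₀₁ b₁₁ : Expr k) → Expr k
det₂ b₀₀ b₀₁ b₁₁ = b₀₀ :* b₁₁ :+ :- (b₀₁ :* b₀₁)

-- The 2×2 pivot block has odd determinant d, and d² ≡ 1 (mod 8); so d times the
-- adjugate inverts the block mod 4. These are the row multipliers clearing (x₀ , x₁).
multiplier₀ multiplier₁ : ∀ {k} (b₀₀ b₀₁ b₁₁ x₀ x₁ : Expr k) → Expr k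
multiplier₀ b₀₀ b₀₁ b₁₁ x₀ x₁ = det₂ b₀₀ b₀₁ b₁₁ :* (x₀ :* b₁₁ :+ :- (x₁ :* b₀₁))
multiplier₁ b₀₀ b₀₁ b₁₁ x₀ x₁ = det₂ b₀₀ b₀₁ b₁₁ :* (:- (x₀ :* b₀₁) :+ x₁ :* b₀₀)

module Clearing where
  b₀₀ b₀₁ b₁₁ x₀ x₁ : Expr 5
  b₀₀ = var 0F
  b₀₁ = var 1F
  b₁₁ = var 2F
  x₀  = var 3F
  x₁  = var 4F
  μ₀ μ₁ cleared₀ cleared₁ : Expr 5
  μ₀ = multiplier₀ b₀₀ b₀₁ b₁₁ x₀ x₁
  μ₁ = multiplier₁ b₀₀ b₀₁ b₁₁ x₀ x₁
  cleared₀ = x₀ :+ :- μ₀ :* b₀₀ :+ :- μ₁ :* b₀₁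
  cleared₁ = x₁ :+ :- μ₀ :* b₀₁ :+ :- μ₁ :* b₁₁

pivot₂-clears : ∀ b₀₀ b₀₁ b₁₁ x₀ x₁ → odd₄ b₀₀ ≡ false → Odd₄ b₀₁ →
                ⟦ Clearing.cleared₀ ⟧₄ (b₀₀ ∷ b₀₁ ∷ b₁₁ ∷ x₀ ∷ x₁ ∷ []) ≡ 0₄ ×
                ⟦ Clearing.cleared₁ ⟧₄ (b₀₀ ∷ b₀₁ ∷ b₁₁ ∷ x₀ ∷ x₁ ∷ []) ≡ 0₄
pivot₂-clears = from-yes (∀₄? λ b₀₀ → ∀₄? λ b₀₁ → ∀₄? λ b₁₁ → ∀₄? λ x₀ → ∀₄? λ x₁ →
  (odd₄ b₀₀ 𝔹.≟ false) →-dec Odd₄? b₀₁ →-dec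
  (⟦ Clearing.cleared₀ ⟧₄ (b₀₀ ∷ b₀₁ ∷ b₁₁ ∷ x₀ ∷ x₁ ∷ []) ≟₄ 0₄) ×-dec
  (⟦ Clearing.cleared₁ ⟧₄ (b₀₀ ∷ b₀₁ ∷ b₁₁ ∷ x₀ ∷ x₁ ∷ []) ≟₄ 0₄))

pivot₂-det-odd : ∀ b₀₀ b₀₁ b₁₁ → odd₄ b₀₀ ≡ false → Odd₄ b₀₁ → Odd₄ (b₀₀ *₄ b₁₁ +₄ -₄ (b₀₁ *₄ b₀₁))
pivot₂-det-odd = from-yes (∀₄? λ b₀₀ → ∀₄? λ b₀₁ → ∀₄? λ b₁₁ →
  (odd₄ b₀₀ 𝔹.≟ false) →-dec Odd₄? b₀₁ →-dec Odd₄? (b₀₀ *₄ b₁₁ +₄ -₄ (b₀₁ *₄ b₀₁)))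

module Block where
  b₀₀ b₀₁ b₁₁ w₀ w₁ γ₀ γ₁ : Expr 7
  b₀₀ = var 0F
  b₀₁ = var 1F
  b₁₁ = var 2F
  w₀  = var 3F
  w₁  = var 4F
  γ₀  = var 5F
  γ₁  = var 6F
  d Bw₀ Bw₁ quadratic-block correction : Expr 7
  d   = det₂ b₀₀ b₀₁ b₁₁
  Bw₀ = b₀₀ :* w₀ :+ (b₀₁ :* w₁ :+ γ₀)
  Bw₁ = b₀₁ :* w₀ :+ (b₁₁ :* w₁ :+ γ₁)
  quadratic-block = w₀ :* Bw₀ :+ (w₁ :* Bw₁ :+ (w₀ :* γ₀ :+ w₁ :* γ₁))
  correction = γ₀ :* (d :* b₁₁ :* γ₀ :+ :- (d :* b₀₁) :* γ₁) :+ γ₁ :* (:- (d :* b₀₁) :* γ₀ :+ d :* b₀₀ :* γ₁)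

pivot₂-block : ∀ b₀₀ b₀₁ b₁₁ w₀ w₁ γ₀ γ₁ → let ρ = b₀₀ ∷ b₀₁ ∷ b₁₁ ∷ w₀ ∷ w₁ ∷ γ₀ ∷ γ₁ ∷ [] in
               odd₄ b₀₀ ≡ false → Odd₄ b₀₁ → odd₄ b₀₀ ≡ odd₄ (⟦ Block.Bw₀ ⟧₄ ρ) → odd₄ b₁₁ ≡ odd₄ (⟦ Block.Bw₁ ⟧₄ ρ) →
               DetRelation 2₄ (⟦ Block.d ⟧₄ ρ) (⟦ Block.quadratic-block ⟧₄ ρ +₄ ⟦ Block.correction ⟧₄ ρ)
pivot₂-block = from-yes (∀₄? λ b₀₀ → ∀₄? λ b₀₁ → ∀₄? λ b₁₁ → ∀₄? λ w₀ → ∀₄? λ w₁ → ∀₄? λ γ₀ → ∀₄? λ γ₁ →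
  let ρ = b₀₀ ∷ b₀₁ ∷ b₁₁ ∷ w₀ ∷ w₁ ∷ γ₀ ∷ γ₁ ∷ [] in
  (odd₄ b₀₀ 𝔹.≟ false) →-dec Odd₄? b₀₁ →-dec (odd₄ b₀₀ 𝔹.≟ odd₄ (⟦ Block.Bw₀ ⟧₄ ρ)) →-dec (odd₄ b₁₁ 𝔹.≟ odd₄ (⟦ Block.Bw₁ ⟧₄ ρ)) →-dec
  DetRelation? 2₄ (⟦ Block.d ⟧₄ ρ) (⟦ Block.quadratic-block ⟧₄ ρ +₄ ⟦ Block.correction ⟧₄ ρ))

module Reduced where
  b₀₀ b₀₁ b₁₁ w₀ w₁ γ₀ γ₁ cᵢᵢ cvᵢ x₀ x₁ : Expr 11
  b₀₀ = var 0F
  b₀₁ = var 1F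
  b₁₁ = var 2F
  w₀  = var 3F
  w₁  = var 4F
  γ₀  = var 5F
  γ₁  = var 6F
  cᵢᵢ = var 7F
  cvᵢ = var 8F
  x₀  = var 9F
  x₁  = var (suc 9F)
  μ₀ μ₁ Bw₀ Bw₁ Bwᵢ Sᵢᵢ Svᵢ : Expr 11
  μ₀  = multiplier₀ b₀₀ b₀₁ b₁₁ x₀ x₁
  μ₁  = multiplier₁ b₀₀ b₀₁ b₁₁ x₀ x₁
  Bw₀ = b₀₀ :* w₀ :+ (b₀₁ :* w₁ :+ γ₀)
  Bw₁ = b₀₁ :* w₀ :+ (b₁₁ :* w₁ :+ γ₁)
  Bwᵢ = x₀ :* w₀ :+ (x₁ :* w₁ :+ cvᵢ)
  Sᵢᵢ = cᵢᵢ :+ :- μ₀ :* x₀ :+ :- μ₁ :* x₁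
  Svᵢ = cvᵢ :+ :- μ₀ :* γ₀ :+ :- μ₁ :* γ₁

pivot₂-characteristic : ∀ b₀₀ b₀₁ b₁₁ w₀ w₁ γ₀ γ₁ cᵢᵢ cvᵢ x₀ x₁ →
  let ρ = b₀₀ ∷ b₀₁ ∷ b₁₁ ∷ w₀ ∷ w₁ ∷ γ₀ ∷ γ₁ ∷ cᵢᵢ ∷ cvᵢ ∷ x₀ ∷ x₁ ∷ [] in
  b₀₀ ≡ false → b₀₁ ≡ true → b₀₀ ≡ ⟦ Reduced.Bw₀ ⟧₂ ρ → b₁₁ ≡ ⟦ Reduced.Bw₁ ⟧₂ ρ → cᵢᵢ ≡ ⟦ Reduced.Bwᵢ ⟧₂ ρ →
  ⟦ Reduced.Sᵢᵢ ⟧₂ ρ ≡ ⟦ Reduced.Svᵢ ⟧₂ ρ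
pivot₂-characteristic = from-yes (∀𝔹? λ b₀₀ → ∀𝔹? λ b₀₁ → ∀𝔹? λ b₁₁ → ∀𝔹? λ w₀ → ∀𝔹? λ w₁ → ∀𝔹? λ γ₀ → ∀𝔹? λ γ₁ →
  ∀𝔹? λ cᵢᵢ → ∀𝔹? λ cvᵢ → ∀𝔹? λ x₀ → ∀𝔹? λ x₁ →
  let ρ = b₀₀ ∷ b₀₁ ∷ b₁₁ ∷ w₀ ∷ w₁ ∷ γ₀ ∷ γ₁ ∷ cᵢᵢ ∷ cvᵢ ∷ x₀ ∷ x₁ ∷ [] in
  (b₀₀ 𝔹.≟ false) →-dec (b₀₁ 𝔹.≟ true) →-dec (b₀₀ 𝔹.≟ ⟦ Reduced.Bw₀ ⟧₂ ρ) →-dec (b₁₁ 𝔹.≟ ⟦ Reduced.Bw₁ ⟧₂ ρ) →-dec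
  (cᵢᵢ 𝔹.≟ ⟦ Reduced.Bwᵢ ⟧₂ ρ) →-dec (⟦ Reduced.Sᵢᵢ ⟧₂ ρ 𝔹.≟ ⟦ Reduced.Svᵢ ⟧₂ ρ))

module Pivot₂ {n} (B : Matrix (suc (suc n))) (w : Fin (suc (suc n)) → ℤ) (B-sym : Symmetric B) (w-char : Characteristic B w)
              (b₀₀-even : parity (B 0F 0F) ≡ false) (b₀₁-odd : parity (B 0F 1F) ≡ true) where

  b₀₀ b₀₁ b₁₁ w₀ w₁ d : ℤ
  b₀₀ = B 0F 0F
  b₀₁ = B 0F 1F
  b₁₁ = B 1F 1F
  w₀  = w 0F
  w₁  = w 1F
  d   = b₀₀ * b₁₁ - b₀₁ * b₀₁

  r₀ r₁ v : Fin n → ℤ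
  r₀ k = B 0F (suc (suc k))
  r₁ k = B 1F (suc (suc k))
  v k  = w (suc (suc k))

  C : Matrix n
  C i k = B (suc (suc i)) (suc (suc k))

  γ₀ γ₁ : ℤ
  γ₀ = r₀ ∙ v
  γ₁ = r₁ ∙ v

  b₁₀≡b₀₁ : B 1F 0F ≡ b₀₁
  b₁₀≡b₀₁ = B-sym 1F 0F

  column₀≡row₀ : ∀ i → B (suc (suc i)) 0F ≡ r₀ i
  column₀≡row₀ i = B-sym (suc (suc i)) 0F

  column₁≡row₁ : ∀ i → B (suc (suc i)) 1F ≡ r₁ i
  column₁≡row₁ i = B-sym (suc (suc i)) 1F

  μ₀ μ₁ : Fin n → ℤ
  μ₀ i = d * (r₀ i * b₁₁ - r₁ i * b₀₁)
  μ₁ i = d * (- (r₀ i * b₀₁) + r₁ i * b₀₀)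

  coeff₀ coeff₁ : Fin (suc (suc n)) → ℤ
  coeff₀ 0F            = + 0
  coeff₀ 1F            = + 0
  coeff₀ (suc (suc i)) = - μ₀ i
  coeff₁ 0F            = + 0
  coeff₁ 1F            = + 0
  coeff₁ (suc (suc i)) = - μ₁ i

  P F : Matrix (suc (suc n))
  P i j = B i j + coeff₀ i * B 0F j
  F i j = P i j + coeff₁ i * B 1F j

  S : Matrix n
  S i k = F (suc (suc i)) (suc (suc k))

  F-row : ∀ i j → coeff₀ i ≡ + 0 → coeff₁ i ≡ + 0 → F i j ≡ B i j
  F-row i j c₀≡0 c₁≡0 = begin
    B i j + coeff₀ i * B 0F j + coeff₁ i * B 1F j  ≡⟨ cong₂ (λ x y → B i j + x * B 0F j + y * B 1F j) c₀≡0 c₁≡0 ⟩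
    B i j + + 0 + + 0                              ≡⟨ trans (ℤP.+-identityʳ _) (ℤP.+-identityʳ _) ⟩
    B i j                                          ∎

  det-preserved : det F ≡ det B
  det-preserved = begin
    det F                                          ≡⟨ det-cong (λ i j → cong (λ x → P i j + coeff₁ i * x) (sym (ℤP.+-identityʳ (B 1F j)))) ⟩
    det (λ i j → P i j + coeff₁ i * P 1F j)        ≡⟨ det-add-multiples-of-row P 1F coeff₁ refl ⟩
    det P                                          ≡⟨ det-add-multiples-of-row B 0F coeff₀ refl ⟩
    det B                                          ∎

  cleared : ∀ i → [ F (suc (suc i)) 0F ]₄ ≡ 0₄ × [ F (suc (suc i)) 1F ]₄ ≡ 0₄
  cleared i =
    trans (cong₂ (λ x y → [ x + - μ₀ i * b₀₀ + - μ₁ i * y ]₄) (column₀≡row₀ i) b₁₀≡b₀₁)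
          (trans ([⟦⟧]₄ Clearing.cleared₀ ρ) (proj₁ clears)) ,
    trans (cong (λ x → [ x + - μ₀ i * b₀₁ + - μ₁ i * b₁₁ ]₄) (column₁≡row₁ i))
          (trans ([⟦⟧]₄ Clearing.cleared₁ ρ) (proj₂ clears))
    where
    ρ : Vector ℤ 5
    ρ = b₀₀ ∷ b₀₁ ∷ b₁₁ ∷ r₀ i ∷ r₁ i ∷ []
    clears : ⟦ Clearing.cleared₀ ⟧₄ (λ k → [ ρ k ]₄) ≡ 0₄ × ⟦ Clearing.cleared₁ ⟧₄ (λ k → [ ρ k ]₄) ≡ 0₄
    clears = pivot₂-clears [ b₀₀ ]₄ [ b₀₁ ]₄ [ b₁₁ ]₄ [ r₀ i ]₄ [ r₁ i ]₄ b₀₀-even b₀₁-odd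

  det-factor : [ det B ]₄ ≡ [ d ]₄ *₄ [ det S ]₄
  det-factor = begin
    [ det B ]₄
      ≡⟨ cong [_]₄ det-preserved ⟨
    [ det F ]₄
      ≡⟨ [det]₄-pivot₂ F (λ i → proj₁ (cleared i)) (λ i → proj₂ (cleared i)) ⟩
    [ F 0F 0F * F 1F 1F - F 1F 0F * F 0F 1F ]₄ *₄ [ det S ]₄
      ≡⟨ cong (λ x → [ x ]₄ *₄ [ det S ]₄)
              (cong₂ _-_ (cong₂ _*_ (F-row 0F 0F refl refl) (F-row 1F 1F refl refl))
                         (cong₂ _*_ (trans (F-row 1F 0F refl refl) b₁₀≡b₀₁) (F-row 0F 1F refl refl))) ⟩
    [ d ]₄ *₄ [ det S ]₄                                         ∎

  S-symmetric : Symmetric S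
  S-symmetric i k = trans (cong (λ c → c + - μ₀ i * r₀ k + - μ₁ i * r₁ k) (B-sym (suc (suc i)) (suc (suc k))))
                          (swap (C k i) d b₀₀ b₀₁ b₁₁ (r₀ i) (r₁ i) (r₀ k) (r₁ k))
    where
    swap : ∀ c d b₀₀ b₀₁ b₁₁ p₀ p₁ q₀ q₁ →
           c + - (d * (p₀ * b₁₁ - p₁ * b₀₁)) * q₀ + - (d * (- (p₀ * b₀₁) + p₁ * b₀₀)) * q₁
           ≡ c + - (d * (q₀ * b₁₁ - q₁ * b₀₁)) * p₀ + - (d * (- (q₀ * b₀₁) + q₁ * b₀₀)) * p₁
    swap = solve-∀

  S·v : ∀ i → (S ·ᵥ v) i ≡ (C ·ᵥ v) i + - μ₀ i * γ₀ + - μ₁ i * γ₁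
  S·v i = begin
    (S ·ᵥ v) i                                           ≡⟨ ∙-linearˡ (λ k → C i k + - μ₀ i * r₀ k) r₁ v (- μ₁ i) ⟩
    (λ k → C i k + - μ₀ i * r₀ k) ∙ v + - μ₁ i * γ₁      ≡⟨ cong (_+ - μ₁ i * γ₁) (∙-linearˡ (C i) r₀ v (- μ₀ i)) ⟩
    (C ·ᵥ v) i + - μ₀ i * γ₀ + - μ₁ i * γ₁               ∎

  S-characteristic : Characteristic S v
  S-characteristic i = begin
    parity (S i i)
      ≡⟨ parity⟦⟧ Reduced.Sᵢᵢ ρ ⟩
    ⟦ Reduced.Sᵢᵢ ⟧₂ (λ k → parity (ρ k))
      ≡⟨ pivot₂-characteristic (parity b₀₀) (parity b₀₁) (parity b₁₁) (parity w₀) (parity w₁) (parity γ₀) (parity γ₁)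
           (parity (C i i)) (parity ((C ·ᵥ v) i)) (parity (r₀ i)) (parity (r₁ i))
           b₀₀-even b₀₁-odd
           (trans (w-char 0F) (parity⟦⟧ Reduced.Bw₀ ρ))
           (trans (w-char 1F) (trans (cong (λ x → parity (x * w₀ + (b₁₁ * w₁ + γ₁))) b₁₀≡b₀₁) (parity⟦⟧ Reduced.Bw₁ ρ)))
           (trans (w-char (suc (suc i)))
                  (trans (cong₂ (λ x y → parity (x * w₀ + (y * w₁ + (C ·ᵥ v) i))) (column₀≡row₀ i) (column₁≡row₁ i))
                         (parity⟦⟧ Reduced.Bwᵢ ρ))) ⟩
    ⟦ Reduced.Svᵢ ⟧₂ (λ k → parity (ρ k))
      ≡⟨ parity⟦⟧ Reduced.Svᵢ ρ ⟨
    parity ((C ·ᵥ v) i + - μ₀ i * γ₀ + - μ₁ i * γ₁)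
      ≡⟨ cong parity (S·v i) ⟨
    parity ((S ·ᵥ v) i) ∎
    where
    ρ : Vector ℤ 11
    ρ = b₀₀ ∷ b₀₁ ∷ b₁₁ ∷ w₀ ∷ w₁ ∷ γ₀ ∷ γ₁ ∷ C i i ∷ (C ·ᵥ v) i ∷ r₀ i ∷ r₁ i ∷ []

  ρ : Vector ℤ 7
  ρ = b₀₀ ∷ b₀₁ ∷ b₁₁ ∷ w₀ ∷ w₁ ∷ γ₀ ∷ γ₁ ∷ []

  quadratic-B : quadratic B w ≡ ⟦ Block.quadratic-block ⟧ ρ + quadratic C v
  quadratic-B = begin
    w₀ * (b₀₀ * w₀ + (b₀₁ * w₁ + γ₀)) + (w₁ * (B 1F 0F * w₀ + (b₁₁ * w₁ + γ₁)) + v ∙ (λ i → B (suc (suc i)) 0F * w₀ + (B (suc (suc i)) 1F * w₁ + (C ·ᵥ v) i)))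
      ≡⟨ cong₂ (λ x y → w₀ * (b₀₀ * w₀ + (b₀₁ * w₁ + γ₀)) + (w₁ * (x * w₀ + (b₁₁ * w₁ + γ₁)) + y)) b₁₀≡b₀₁ rest ⟩
    w₀ * (b₀₀ * w₀ + (b₀₁ * w₁ + γ₀)) + (w₁ * (b₀₁ * w₀ + (b₁₁ * w₁ + γ₁)) + (quadratic C v + (w₀ * γ₀ + w₁ * γ₁)))
      ≡⟨ regroup w₀ w₁ (b₀₀ * w₀ + (b₀₁ * w₁ + γ₀)) (b₀₁ * w₀ + (b₁₁ * w₁ + γ₁)) γ₀ γ₁ (quadratic C v) ⟩
    ⟦ Block.quadratic-block ⟧ ρ + quadratic C v ∎
    where
    regroup : ∀ w₀ w₁ p q γ₀ γ₁ c → w₀ * p + (w₁ * q + (c + (w₀ * γ₀ + w₁ * γ₁))) ≡ (w₀ * p + (w₁ * q + (w₀ * γ₀ + w₁ * γ₁))) + c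
    regroup = solve-∀
    reorder : ∀ i → B (suc (suc i)) 0F * w₀ + (B (suc (suc i)) 1F * w₁ + (C ·ᵥ v) i) ≡ (C ·ᵥ v) i + (w₀ * r₀ i + w₁ * r₁ i)
    reorder i = trans (cong₂ (λ x y → x * w₀ + (y * w₁ + (C ·ᵥ v) i)) (column₀≡row₀ i) (column₁≡row₁ i))
                      (commute (r₀ i) (r₁ i) w₀ w₁ ((C ·ᵥ v) i))
      where
      commute : ∀ x y w₀ w₁ c → x * w₀ + (y * w₁ + c) ≡ c + (w₀ * x + w₁ * y)
      commute = solve-∀
    rest : v ∙ (λ i → B (suc (suc i)) 0F * w₀ + (B (suc (suc i)) 1F * w₁ + (C ·ᵥ v) i)) ≡ quadratic C v + (w₀ * γ₀ + w₁ * γ₁)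
    rest = begin
      v ∙ (λ i → B (suc (suc i)) 0F * w₀ + (B (suc (suc i)) 1F * w₁ + (C ·ᵥ v) i))
        ≡⟨ ∙-congʳ v reorder ⟩
      v ∙ (λ i → (C ·ᵥ v) i + (w₀ * r₀ i + w₁ * r₁ i))
        ≡⟨ ∙-distrib-+ʳ v (C ·ᵥ v) (λ i → w₀ * r₀ i + w₁ * r₁ i) ⟩
      quadratic C v + v ∙ (λ i → w₀ * r₀ i + w₁ * r₁ i)
        ≡⟨ cong (_+_ (quadratic C v)) (∙-bilinearʳ v r₀ r₁ w₀ w₁) ⟩
      quadratic C v + (w₀ * (v ∙ r₀) + w₁ * (v ∙ r₁))
        ≡⟨ cong₂ (λ x y → quadratic C v + (w₀ * x + w₁ * y)) (∙-comm v r₀) (∙-comm v r₁) ⟩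
      quadratic C v + (w₀ * γ₀ + w₁ * γ₁) ∎

  quadratic-S : quadratic S v ≡ quadratic C v + - ⟦ Block.correction ⟧ ρ
  quadratic-S = begin
    v ∙ (S ·ᵥ v)
      ≡⟨ ∙-congʳ v (λ i → trans (S·v i) (reorder ((C ·ᵥ v) i) (μ₀ i) (μ₁ i) γ₀ γ₁)) ⟩
    v ∙ (λ i → (C ·ᵥ v) i + (- γ₀ * μ₀ i + - γ₁ * μ₁ i))
      ≡⟨ ∙-distrib-+ʳ v (C ·ᵥ v) (λ i → - γ₀ * μ₀ i + - γ₁ * μ₁ i) ⟩
    quadratic C v + v ∙ (λ i → - γ₀ * μ₀ i + - γ₁ * μ₁ i)
      ≡⟨ cong (_+_ (quadratic C v)) (∙-bilinearʳ v μ₀ μ₁ (- γ₀) (- γ₁)) ⟩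
    quadratic C v + (- γ₀ * (v ∙ μ₀) + - γ₁ * (v ∙ μ₁))
      ≡⟨ cong₂ (λ x y → quadratic C v + (- γ₀ * x + - γ₁ * y)) v∙μ₀ v∙μ₁ ⟩
    quadratic C v + (- γ₀ * (d * b₁₁ * γ₀ + - (d * b₀₁) * γ₁) + - γ₁ * (- (d * b₀₁) * γ₀ + d * b₀₀ * γ₁))
      ≡⟨ cong (_+_ (quadratic C v)) (negate γ₀ γ₁ (d * b₁₁) (d * b₀₁) (d * b₀₀)) ⟩
    quadratic C v + - ⟦ Block.correction ⟧ ρ ∎
    where
    reorder : ∀ c a b g₀ g₁ → c + - a * g₀ + - b * g₁ ≡ c + (- g₀ * a + - g₁ * b)
    reorder = solve-∀
    negate : ∀ g₀ g₁ p q s → - g₀ * (p * g₀ + - q * g₁) + - g₁ * (- q * g₀ + s * g₁) ≡ - (g₀ * (p * g₀ + - q * g₁) + g₁ * (- q * g₀ + s * g₁))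
    negate = solve-∀
    v∙μ₀ : v ∙ μ₀ ≡ d * b₁₁ * γ₀ + - (d * b₀₁) * γ₁
    v∙μ₀ = begin
      v ∙ μ₀
        ≡⟨ ∙-congʳ v (λ i → expand d (r₀ i) (r₁ i) b₁₁ b₀₁) ⟩
      v ∙ (λ i → d * b₁₁ * r₀ i + - (d * b₀₁) * r₁ i)
        ≡⟨ ∙-bilinearʳ v r₀ r₁ (d * b₁₁) (- (d * b₀₁)) ⟩
      d * b₁₁ * (v ∙ r₀) + - (d * b₀₁) * (v ∙ r₁)
        ≡⟨ cong₂ (λ x y → d * b₁₁ * x + - (d * b₀₁) * y) (∙-comm v r₀) (∙-comm v r₁) ⟩
      d * b₁₁ * γ₀ + - (d * b₀₁) * γ₁ ∎
      where
      expand : ∀ d x y b₁₁ b₀₁ → d * (x * b₁₁ - y * b₀₁) ≡ d * b₁₁ * x + - (d * b₀₁) * y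
      expand = solve-∀
    v∙μ₁ : v ∙ μ₁ ≡ - (d * b₀₁) * γ₀ + d * b₀₀ * γ₁
    v∙μ₁ = begin
      v ∙ μ₁
        ≡⟨ ∙-congʳ v (λ i → expand d (r₀ i) (r₁ i) b₀₀ b₀₁) ⟩
      v ∙ (λ i → - (d * b₀₁) * r₀ i + d * b₀₀ * r₁ i)
        ≡⟨ ∙-bilinearʳ v r₀ r₁ (- (d * b₀₁)) (d * b₀₀) ⟩
      - (d * b₀₁) * (v ∙ r₀) + d * b₀₀ * (v ∙ r₁)
        ≡⟨ cong₂ (λ x y → - (d * b₀₁) * x + d * b₀₀ * y) (∙-comm v r₀) (∙-comm v r₁) ⟩
      - (d * b₀₁) * γ₀ + d * b₀₀ * γ₁ ∎
      where
      expand : ∀ d x y b₀₀ b₀₁ → d * (- (x * b₀₁) + y * b₀₀) ≡ - (d * b₀₁) * x + d * b₀₀ * y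
      expand = solve-∀

  quadratic-split : quadratic B w ≡ (⟦ Block.quadratic-block ⟧ ρ + ⟦ Block.correction ⟧ ρ) + quadratic S v
  quadratic-split = begin
    quadratic B w
      ≡⟨ quadratic-B ⟩
    ⟦ Block.quadratic-block ⟧ ρ + quadratic C v
      ≡⟨ regroup (⟦ Block.quadratic-block ⟧ ρ) (⟦ Block.correction ⟧ ρ) (quadratic C v) ⟩
    (⟦ Block.quadratic-block ⟧ ρ + ⟦ Block.correction ⟧ ρ) + (quadratic C v + - ⟦ Block.correction ⟧ ρ)
      ≡⟨ cong (_+_ (⟦ Block.quadratic-block ⟧ ρ + ⟦ Block.correction ⟧ ρ)) quadratic-S ⟨
    (⟦ Block.quadratic-block ⟧ ρ + ⟦ Block.correction ⟧ ρ) + quadratic S v ∎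
    where
    regroup : ∀ q y c → q + c ≡ (q + y) + (c + - y)
    regroup = solve-∀

  relation : CharacteristicDetRelation n → DetRelation [ suc (suc n) ]ℕ₄ [ det B ]₄ [ quadratic B w ]₄
  relation IH = subst₂ (DetRelation (2₄ +₄ [ n ]ℕ₄)) (sym [det]₄) (sym [quadratic]₄)
    (DetRelation-⊕ 2₄ (⟦ Block.d ⟧₄ ρ₄) (⟦ Block.quadratic-block ⟧₄ ρ₄ +₄ ⟦ Block.correction ⟧₄ ρ₄)
                   [ n ]ℕ₄ [ det S ]₄ [ quadratic S v ]₄
      (pivot₂-det-odd [ b₀₀ ]₄ [ b₀₁ ]₄ [ b₁₁ ]₄ b₀₀-even b₀₁-odd)
      (pivot₂-block [ b₀₀ ]₄ [ b₀₁ ]₄ [ b₁₁ ]₄ [ w₀ ]₄ [ w₁ ]₄ [ γ₀ ]₄ [ γ₁ ]₄ b₀₀-even b₀₁-odd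
        (trans (w-char 0F) (cong odd₄ ([⟦⟧]₄ Block.Bw₀ ρ)))
        (trans (w-char 1F) (trans (cong (λ x → parity (x * w₀ + (b₁₁ * w₁ + γ₁))) b₁₀≡b₀₁) (cong odd₄ ([⟦⟧]₄ Block.Bw₁ ρ)))))
      (IH S v S-symmetric S-characteristic))
    where
    ρ₄ : Vector ℤ₄ 7
    ρ₄ i = [ ρ i ]₄
    [det]₄ : [ det B ]₄ ≡ ⟦ Block.d ⟧₄ ρ₄ *₄ [ det S ]₄
    [det]₄ = trans det-factor (cong (_*₄ [ det S ]₄) ([⟦⟧]₄ Block.d ρ))
    [quadratic]₄ : [ quadratic B w ]₄ ≡ (⟦ Block.quadratic-block ⟧₄ ρ₄ +₄ ⟦ Block.correction ⟧₄ ρ₄) +₄ [ quadratic S v ]₄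
    [quadratic]₄ = begin
      [ quadratic B w ]₄
        ≡⟨ cong [_]₄ quadratic-split ⟩
      [ (⟦ Block.quadratic-block ⟧ ρ + ⟦ Block.correction ⟧ ρ) + quadratic S v ]₄
        ≡⟨ [⟦⟧]₄ (var 0F :+ var 1F :+ var 2F) (⟦ Block.quadratic-block ⟧ ρ ∷ ⟦ Block.correction ⟧ ρ ∷ quadratic S v ∷ []) ⟩
      [ ⟦ Block.quadratic-block ⟧ ρ ]₄ +₄ [ ⟦ Block.correction ⟧ ρ ]₄ +₄ [ quadratic S v ]₄
        ≡⟨ cong₂ (λ x y → x +₄ y +₄ [ quadratic S v ]₄) ([⟦⟧]₄ Block.quadratic-block ρ) ([⟦⟧]₄ Block.correction ρ) ⟩
      (⟦ Block.quadratic-block ⟧₄ ρ₄ +₄ ⟦ Block.correction ⟧₄ ρ₄) +₄ [ quadratic S v ]₄ ∎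

module Conjugate {n} (B : Matrix n) (w : Fin n → ℤ) {a b : Fin n} (a≢b : a ≢ b) where

  τ : Fin n → Fin n
  τ = transpose a b

  B′ : Matrix n
  B′ i j = B (τ i) (τ j)

  w′ : Fin n → ℤ
  w′ i = w (τ i)

  symmetric : Symmetric B → Symmetric B′
  symmetric B-sym i j = B-sym (τ i) (τ j)

  B′·w′ : ∀ i → (B′ ·ᵥ w′) i ≡ (B ·ᵥ w) (τ i)
  B′·w′ i = sumℤ-transpose a b (λ j → B (τ i) j * w j)

  characteristic : Characteristic B w → Characteristic B′ w′
  characteristic w-char i = trans (w-char (τ i)) (cong parity (sym (B′·w′ i)))

  relation : ∀ m → DetRelation m [ det B′ ]₄ [ quadratic B′ w′ ]₄ → DetRelation m [ det B ]₄ [ quadratic B w ]₄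
  relation m = subst₂ (λ D Q → DetRelation m [ D ]₄ [ Q ]₄) (det-conjugate-transpose B a≢b) quadratic-preserved
    where
    quadratic-preserved : quadratic B′ w′ ≡ quadratic B w
    quadratic-preserved = trans (sumℤ-cong (λ i → cong (w′ i *_) (B′·w′ i))) (sumℤ-transpose a b (λ i → w i * (B ·ᵥ w) i))

relation₀ : CharacteristicDetRelation 0
relation₀ B w _ _ = refl

relation₁ : CharacteristicDetRelation 1
relation₁ B w _ w-char = subst₂ (DetRelation 1₄) (sym (cong [_]₄ (det₁ b))) (sym [quadratic]₄)
  (DetRelation-1×1 [ b ]₄ [ w₀ ]₄ (trans (w-char 0F) (trans (cong parity (ℤP.+-identityʳ (b * w₀))) (cong odd₄ ([*]₄ b w₀)))))
  where
  b w₀ : ℤ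
  b  = B 0F 0F
  w₀ = w 0F
  det₁ : ∀ b → + 1 * b * + 1 + + 0 ≡ b
  det₁ = solve-∀
  quadratic₁ : ∀ b w₀ → w₀ * (b * w₀ + + 0) + + 0 ≡ w₀ * (b * w₀)
  quadratic₁ = solve-∀
  [quadratic]₄ : [ quadratic B w ]₄ ≡ [ w₀ ]₄ *₄ ([ b ]₄ *₄ [ w₀ ]₄)
  [quadratic]₄ = trans (cong [_]₄ (quadratic₁ b w₀)) ([⟦⟧]₄ (var 0F :* (var 1F :* var 0F)) (w₀ ∷ b ∷ []))

module _ {m} (IH₁ : CharacteristicDetRelation (suc m)) (IH₀ : CharacteristicDetRelation m) where

  Odd-in-row₀ : Matrix (suc (suc m)) → Set
  Odd-in-row₀ B = ∃ λ j → parity (B 0F j) ≡ true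

  relation-odd-in-row₀ : ∀ B w → Symmetric B → Characteristic B w → Odd-in-row₀ B →
                         DetRelation [ suc (suc m) ]ℕ₄ [ det B ]₄ [ quadratic B w ]₄
  relation-odd-in-row₀ B w B-sym w-char (j , odd) with parity (B 0F 0F) in b₀₀-parity
  ... | true  = Pivot₁.relation B w B-sym w-char b₀₀-parity IH₁
  relation-odd-in-row₀ B w B-sym w-char (0F , odd) | false = contradiction (trans (sym b₀₀-parity) odd) λ ()
  relation-odd-in-row₀ B w B-sym w-char (1F , odd) | false = Pivot₂.relation B w B-sym w-char b₀₀-parity odd IH₀
  relation-odd-in-row₀ B w B-sym w-char (suc (suc j) , odd) | false =
    Conjugate.relation B w 1≢j _ (Pivot₂.relation B′ w′ (symmetric B-sym) (characteristic w-char) b₀₀-parity odd IH₀)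
    where
    1≢j : 1F ≢ suc (suc j)
    1≢j ()
    open Conjugate B w 1≢j using (B′; w′; symmetric; characteristic)

  relation-step : CharacteristicDetRelation (suc (suc m))
  relation-step B w B-sym w-char with any? (λ j → parity (B 0F j) 𝔹.≟ true)
  ... | yes odd-in-row₀ = relation-odd-in-row₀ B w B-sym w-char odd-in-row₀
  ... | no all-even-row₀ with any? (λ i → any? (λ j → parity (B i j) 𝔹.≟ true))
  ...   | yes (0F , odd-entry)       = contradiction odd-entry all-even-row₀
  ...   | yes (suc i , (j , odd))    =
    Conjugate.relation B w 0≢i _ (relation-odd-in-row₀ B′ w′ (symmetric B-sym) (characteristic w-char)
      (τ j , trans (cong (λ k → parity (B (suc i) k)) (transpose-involutive 0F (suc i) 0≢i j)) odd))
    where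
    0≢i : 0F ≢ suc i
    0≢i ()
    open Conjugate B w 0≢i using (τ; B′; w′; symmetric; characteristic)
  ...   | no all-even = subst (λ D → DetRelation [ suc (suc m) ]ℕ₄ D [ quadratic B w ]₄) (sym det≡0) refl
    where
    even : ∀ i j → parity (B i j) ≡ false
    even i j = 𝔹.¬-not (λ odd → all-even (i , j , odd))
    det≡0 : [ det B ]₄ ≡ 0₄
    det≡0 = [det]₄-two-rows-even B (even 0F) (even 1F)

characteristic-det-relation : ∀ n → CharacteristicDetRelation n
characteristic-det-relation zero          = relation₀
characteristic-det-relation (suc zero)    = relation₁
characteristic-det-relation (suc (suc m)) = relation-step (characteristic-det-relation (suc m)) (characteristic-det-relation m)

-- The trace form of a ring

-- Off-diagonal terms of a symmetric double sum come in equal pairs.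
parity-double-sum-symmetric : ∀ {n} (g : Matrix n) → Symmetric g → parity (sumℤ (λ a → sumℤ (g a))) ≡ parity (sumℤ (λ a → g a a))
parity-double-sum-symmetric {zero}  g g-sym = refl
parity-double-sum-symmetric {suc n} g g-sym = begin
  parity ((g zero zero + row) + sumℤ (λ a → g (suc a) zero + sumℤ (λ k → g (suc a) (suc k))))
    ≡⟨ cong (λ x → parity ((g zero zero + row) + x)) (sumℤ-distrib-+ (λ a → g (suc a) zero) (λ a → sumℤ (λ k → g (suc a) (suc k)))) ⟩
  parity ((g zero zero + row) + (column + inner))
    ≡⟨ parity⟦⟧ (var 0F :+ var 1F :+ (var 2F :+ var 3F)) (g zero zero ∷ row ∷ column ∷ inner ∷ []) ⟩
  (parity (g zero zero) xor parity row) xor (parity column xor parity inner)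
    ≡⟨ cong (λ x → (parity (g zero zero) xor parity row) xor (parity x xor parity inner)) column≡row ⟩
  (parity (g zero zero) xor parity row) xor (parity row xor parity inner)
    ≡⟨ cancel (parity (g zero zero)) (parity row) (parity inner) ⟩
  parity (g zero zero) xor parity inner
    ≡⟨ cong (parity (g zero zero) xor_) (parity-double-sum-symmetric (λ a k → g (suc a) (suc k)) (λ a k → g-sym (suc a) (suc k))) ⟩
  parity (g zero zero) xor parity (sumℤ (λ a → g (suc a) (suc a)))
    ≡⟨ parity-+ (g zero zero) _ ⟨
  parity (sumℤ (λ a → g a a)) ∎
  where
  row column inner : ℤ
  row    = sumℤ (λ k → g zero (suc k))
  column = sumℤ (λ a → g (suc a) zero)
  inner  = sumℤ (λ a → sumℤ (λ k → g (suc a) (suc k)))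
  column≡row : column ≡ row
  column≡row = sumℤ-cong (λ a → g-sym (suc a) zero)
  cancel : ∀ x y z → (x xor y) xor (y xor z) ≡ x xor z
  cancel = from-yes (∀𝔹? λ x → ∀𝔹? λ y → ∀𝔹? λ z → (x xor y) xor (y xor z) 𝔹.≟ x xor z)

parity-trace-square : ∀ {n} (L : Matrix n) → parity (sumℤ (λ a → sumℤ (λ k → L a k * L k a))) ≡ parity (sumℤ (λ a → L a a))
parity-trace-square L = begin
  parity (sumℤ (λ a → sumℤ (λ k → L a k * L k a)))
    ≡⟨ parity-double-sum-symmetric (λ a k → L a k * L k a) (λ a k → ℤP.*-comm (L a k) (L k a)) ⟩
  parity (sumℤ (λ a → L a a * L a a))
    ≡⟨ parity-sumℤ-cong _ _ (λ a → trans (parity⟦⟧ (var 0F :* var 0F) (L a a ∷ [])) (𝔹.∧-idem _)) ⟩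
  parity (sumℤ (λ a → L a a)) ∎

module ℤ-Action {c ℓ} (A : Ring c ℓ) where

  private
    module A = Ring A
    module ≈ = SetoidReasoning A.setoid
  open RingProperties A using (-‿distribˡ-*; -‿distribʳ-*; -‿+-comm; -0#≈0#)
  open SemiringMult A.semiring using (×-homo-+; ×-comm-*; ×-assoc-*) renaming (_×_ to _·ₙ_)
  open CommutativeSemigroupProperties A.+-commutativeSemigroup using (interchange)

  nmul≡× : ∀ k x → nmul A k x ≡ k ·ₙ x
  nmul≡× zero    x = refl
  nmul≡× (suc k) x = cong (x A.+_) (nmul≡× k x)

  nmul-+ : ∀ m k x → nmul A (m ℕ.+ k) x A.≈ nmul A m x A.+ nmul A k x
  nmul-+ m k x rewrite nmul≡× (m ℕ.+ k) x | nmul≡× m x | nmul≡× k x = ×-homo-+ x m k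

  zmul-⊖ : ∀ m k x → zmul A (m ⊖ k) x A.≈ nmul A m x A.- nmul A k x
  zmul-⊖ m       zero    x = A.sym (A.trans (A.+-congˡ -0#≈0#) (A.+-identityʳ _))
  zmul-⊖ zero    (suc k) x = A.sym (A.+-identityˡ _)
  zmul-⊖ (suc m) (suc k) x = ≈.begin
    zmul A (suc m ⊖ suc k) x                      ≈.≡⟨ cong (λ z → zmul A z x) (ℤP.[1+m]⊖[1+n]≡m⊖n m k) ⟩
    zmul A (m ⊖ k) x                              ≈.≈⟨ zmul-⊖ m k x ⟩
    nmul A m x A.- nmul A k x                     ≈.≈⟨ cancel (nmul A m x) (nmul A k x) ⟨
    nmul A (suc m) x A.- nmul A (suc k) x         ≈.∎
    where
    cancel : ∀ a b → (x A.+ a) A.- (x A.+ b) A.≈ a A.- b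
    cancel a b = ≈.begin
      (x A.+ a) A.+ A.- (x A.+ b)         ≈.≈⟨ A.+-congˡ (-‿+-comm x b) ⟨
      (x A.+ a) A.+ (A.- x A.+ A.- b)     ≈.≈⟨ interchange x a (A.- x) (A.- b) ⟩
      (x A.- x) A.+ (a A.- b)             ≈.≈⟨ A.+-congʳ (A.-‿inverseʳ x) ⟩
      A.0# A.+ (a A.- b)                  ≈.≈⟨ A.+-identityˡ _ ⟩
      a A.- b                             ≈.∎

  zmul-+ : ∀ a b x → zmul A (a + b) x A.≈ zmul A a x A.+ zmul A b x
  zmul-+ (+ m)    (+ k)    x = nmul-+ m k x
  zmul-+ (+ m)    -[1+ k ] x = zmul-⊖ m (suc k) x
  zmul-+ -[1+ m ] (+ k)    x = A.trans (zmul-⊖ k (suc m) x) (A.+-comm _ _)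
  zmul-+ -[1+ m ] -[1+ k ] x = ≈.begin
    A.- nmul A (suc (suc (m ℕ.+ k))) x                 ≈.≡⟨ cong (λ z → A.- nmul A (suc z) x) (ℕP.+-suc m k) ⟨
    A.- nmul A (suc m ℕ.+ suc k) x                     ≈.≈⟨ A.-‿cong (nmul-+ (suc m) (suc k) x) ⟩
    A.- (nmul A (suc m) x A.+ nmul A (suc k) x)        ≈.≈⟨ -‿+-comm _ _ ⟨
    A.- nmul A (suc m) x A.+ A.- nmul A (suc k) x      ≈.∎

  zmul-*ʳ : ∀ k x y → x A.* zmul A k y A.≈ zmul A k (x A.* y)
  zmul-*ʳ (+ k)    x y rewrite nmul≡× k y | nmul≡× k (x A.* y) = ×-comm-* k x y
  zmul-*ʳ -[1+ k ] x y = A.trans (A.sym (-‿distribʳ-* x _)) (A.-‿cong (zmul-*ʳ (+ suc k) x y))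

  zmul-*ˡ : ∀ k x y → zmul A k x A.* y A.≈ zmul A k (x A.* y)
  zmul-*ˡ (+ k)    x y rewrite nmul≡× k x | nmul≡× k (x A.* y) = ×-assoc-* k x y
  zmul-*ˡ -[1+ k ] x y = A.trans (A.sym (-‿distribˡ-* _ y)) (A.-‿cong (zmul-*ˡ (+ suc k) x y))

δ : ∀ {n} → Fin n → Fin n → ℤ
δ zero    zero    = + 1
δ zero    (suc _) = + 0
δ (suc _) zero    = + 0
δ (suc a) (suc b) = δ a b

δ-diagonal : ∀ {n} (a : Fin n) → δ a a ≡ + 1
δ-diagonal zero    = refl
δ-diagonal (suc a) = δ-diagonal a

module TraceForm {c ℓ} (A : Ring c ℓ) {n} (β : Basis A n) where

  private
    module A = Ring A
    module ≈ = SetoidReasoning A.setoid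
    module ΣA = SemiringSum A.semiring
  open ℤ-Action A
  open Basis β

  sumR≡sum : ∀ {m} (f : Fin m → A.Carrier) → sumR A f ≡ ΣA.sum f
  sumR≡sum {zero}  f = refl
  sumR≡sum {suc m} f = cong (f zero A.+_) (sumR≡sum (λ i → f (suc i)))

  sumR-cong : ∀ {m} {f g : Fin m → A.Carrier} → (∀ i → f i A.≈ g i) → sumR A f A.≈ sumR A g
  sumR-cong {f = f} {g} f≈g = ≈.begin
    sumR A f   ≈.≡⟨ sumR≡sum f ⟩
    ΣA.sum f   ≈.≈⟨ ΣA.sum-cong-≋ f≈g ⟩
    ΣA.sum g   ≈.≡⟨ sumR≡sum g ⟨
    sumR A g   ≈.∎

  sumR-distrib-+ : ∀ {m} (f g : Fin m → A.Carrier) → sumR A (λ i → f i A.+ g i) A.≈ sumR A f A.+ sumR A g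
  sumR-distrib-+ f g = ≈.begin
    sumR A (λ i → f i A.+ g i)    ≈.≡⟨ sumR≡sum (λ i → f i A.+ g i) ⟩
    ΣA.sum (λ i → f i A.+ g i)    ≈.≈⟨ ΣA.∑-distrib-+ f g ⟩
    ΣA.sum f A.+ ΣA.sum g         ≈.≡⟨ cong₂ A._+_ (sumR≡sum f) (sumR≡sum g) ⟨
    sumR A f A.+ sumR A g         ≈.∎

  *-distribˡ-sumR : ∀ {m} x (f : Fin m → A.Carrier) → x A.* sumR A f A.≈ sumR A (λ i → x A.* f i)
  *-distribˡ-sumR x f = ≈.begin
    x A.* sumR A f               ≈.≡⟨ cong (x A.*_) (sumR≡sum f) ⟩
    x A.* ΣA.sum f               ≈.≈⟨ ΣA.*-distribˡ-sum x f ⟩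
    ΣA.sum (λ i → x A.* f i)     ≈.≡⟨ sumR≡sum (λ i → x A.* f i) ⟨
    sumR A (λ i → x A.* f i)     ≈.∎

  sumR-δ : ∀ {m} (a : Fin m) (f : Fin m → A.Carrier) → sumR A (λ j → zmul A (δ a j) (f j)) A.≈ f a
  sumR-δ {suc m} zero    f = ≈.begin
    (f zero A.+ A.0#) A.+ sumR A {m} (λ _ → A.0#)
      ≈.≈⟨ A.+-cong (A.+-identityʳ (f zero)) (A.trans (A.reflexive (sumR≡sum {m} (λ _ → A.0#))) (ΣA.sum-replicate-zero m)) ⟩
    f zero A.+ A.0#
      ≈.≈⟨ A.+-identityʳ (f zero) ⟩
    f zero ≈.∎
  sumR-δ {suc m} (suc a) f = A.trans (A.+-identityˡ _) (sumR-δ a (λ j → f (suc j)))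

  coord-+ : ∀ x y i → coord (x A.+ y) i ≡ coord x i + coord y i
  coord-+ x y i = trans (coord-cong x+y≈ i) (unique (λ j → coord x j + coord y j) i)
    where
    x+y≈ : x A.+ y A.≈ sumR A (λ j → zmul A (coord x j + coord y j) (e j))
    x+y≈ = ≈.begin
      x A.+ y
        ≈.≈⟨ A.+-cong (expand x) (expand y) ⟩
      sumR A (λ j → zmul A (coord x j) (e j)) A.+ sumR A (λ j → zmul A (coord y j) (e j))
        ≈.≈⟨ sumR-distrib-+ (λ j → zmul A (coord x j) (e j)) (λ j → zmul A (coord y j) (e j)) ⟨
      sumR A (λ j → zmul A (coord x j) (e j) A.+ zmul A (coord y j) (e j))
        ≈.≈⟨ sumR-cong (λ j → A.sym (zmul-+ (coord x j) (coord y j) (e j))) ⟩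
      sumR A (λ j → zmul A (coord x j + coord y j) (e j)) ≈.∎

  coord-0# : ∀ i → coord A.0# i ≡ + 0
  coord-0# i = trans (coord-cong 0≈ i) (unique (λ _ → + 0) i)
    where
    0≈ : A.0# A.≈ sumR A {n} (λ _ → A.0#)
    0≈ = A.sym (A.trans (A.reflexive (sumR≡sum {n} (λ _ → A.0#))) (ΣA.sum-replicate-zero n))

  coord-- : ∀ x i → coord (A.- x) i ≡ - coord x i
  coord-- x i = ℤGroup.inverseʳ-unique (coord x i) (coord (A.- x) i) (begin
    coord x i + coord (A.- x) i   ≡⟨ coord-+ x (A.- x) i ⟨
    coord (x A.- x) i             ≡⟨ coord-cong (A.-‿inverseʳ x) i ⟩
    coord A.0# i                  ≡⟨ coord-0# i ⟩
    + 0                           ∎)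

  coord-nmul : ∀ k x i → coord (nmul A k x) i ≡ + k * coord x i
  coord-nmul zero    x i = trans (coord-0# i) (sym (ℤP.*-zeroˡ (coord x i)))
  coord-nmul (suc k) x i = begin
    coord (x A.+ nmul A k x) i        ≡⟨ coord-+ x (nmul A k x) i ⟩
    coord x i + coord (nmul A k x) i  ≡⟨ cong (_+_ (coord x i)) (coord-nmul k x i) ⟩
    coord x i + + k * coord x i       ≡⟨ ℤP.suc-* (+ k) (coord x i) ⟨
    + suc k * coord x i               ∎

  coord-zmul : ∀ k x i → coord (zmul A k x) i ≡ k * coord x i
  coord-zmul (+ k)     x i = coord-nmul k x i
  coord-zmul -[1+ k ]  x i = begin
    coord (A.- nmul A (suc k) x) i    ≡⟨ coord-- (nmul A (suc k) x) i ⟩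
    - coord (nmul A (suc k) x) i      ≡⟨ cong -_ (coord-nmul (suc k) x i) ⟩
    - (+ suc k * coord x i)           ≡⟨ ℤP.neg-distribˡ-* (+ suc k) (coord x i) ⟩
    -[1+ k ] * coord x i              ∎

  coord-sumR : ∀ {m} (f : Fin m → A.Carrier) i → coord (sumR A f) i ≡ sumℤ (λ j → coord (f j) i)
  coord-sumR {zero}  f i = coord-0# i
  coord-sumR {suc m} f i = trans (coord-+ (f zero) (sumR A (λ j → f (suc j))) i) (cong (_+_ (coord (f zero) i)) (coord-sumR (λ j → f (suc j)) i))

  coord-combination : ∀ {m} (a : Fin m → ℤ) (y : Fin m → A.Carrier) i →
                      coord (sumR A (λ j → zmul A (a j) (y j))) i ≡ sumℤ (λ j → a j * coord (y j) i)
  coord-combination a y i = trans (coord-sumR (λ j → zmul A (a j) (y j)) i) (sumℤ-cong (λ j → coord-zmul (a j) (y j) i))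

  L : A.Carrier → Matrix n
  L = lam A β

  t : A.Carrier → ℤ
  t x = trace A β (L x)

  t-cong : ∀ {x y} → x A.≈ y → t x ≡ t y
  t-cong x≈y = sumℤ-cong (λ i → coord-cong (A.*-congʳ x≈y) i)

  L-* : ∀ x y i j → L (x A.* y) i j ≡ sumℤ (λ k → L x i k * L y k j)
  L-* x y i j = begin
    coord ((x A.* y) A.* e j) i
      ≡⟨ coord-cong xye i ⟩
    coord (sumR A (λ k → zmul A (coord (y A.* e j) k) (x A.* e k))) i
      ≡⟨ coord-combination (λ k → coord (y A.* e j) k) (λ k → x A.* e k) i ⟩
    sumℤ (λ k → L y k j * L x i k)
      ≡⟨ sumℤ-cong (λ k → ℤP.*-comm (L y k j) (L x i k)) ⟩
    sumℤ (λ k → L x i k * L y k j) ∎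
    where
    xye : (x A.* y) A.* e j A.≈ sumR A (λ k → zmul A (coord (y A.* e j) k) (x A.* e k))
    xye = ≈.begin
      (x A.* y) A.* e j                                          ≈.≈⟨ A.*-assoc x y (e j) ⟩
      x A.* (y A.* e j)                                          ≈.≈⟨ A.*-congˡ (expand (y A.* e j)) ⟩
      x A.* sumR A (λ k → zmul A (coord (y A.* e j) k) (e k))    ≈.≈⟨ *-distribˡ-sumR x (λ k → zmul A (coord (y A.* e j) k) (e k)) ⟩
      sumR A (λ k → x A.* zmul A (coord (y A.* e j) k) (e k))    ≈.≈⟨ sumR-cong (λ k → zmul-*ʳ (coord (y A.* e j) k) x (e k)) ⟩
      sumR A (λ k → zmul A (coord (y A.* e j) k) (x A.* e k))    ≈.∎

  t-combination : ∀ {m} (a : Fin m → ℤ) (y : Fin m → A.Carrier) → t (sumR A (λ j → zmul A (a j) (y j))) ≡ sumℤ (λ j → a j * t (y j))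
  t-combination a y = begin
    sumℤ (λ i → coord (sumR A (λ j → zmul A (a j) (y j)) A.* e i) i)
      ≡⟨ sumℤ-cong (λ i → coord-cong (distribʳ-sumR (e i) (λ j → zmul A (a j) (y j))) i) ⟩
    sumℤ (λ i → coord (sumR A (λ j → zmul A (a j) (y j) A.* e i)) i)
      ≡⟨ sumℤ-cong (λ i → trans (coord-cong (sumR-cong (λ j → zmul-*ˡ (a j) (y j) (e i))) i) (coord-combination a (λ j → y j A.* e i) i)) ⟩
    sumℤ (λ i → sumℤ (λ j → a j * L (y j) i i))
      ≡⟨ sumℤ-comm (λ i j → a j * L (y j) i i) ⟩
    sumℤ (λ j → sumℤ (λ i → a j * L (y j) i i))
      ≡⟨ sumℤ-cong (λ j → *-distribˡ-sumℤ (a j) (λ i → L (y j) i i)) ⟨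
    sumℤ (λ j → a j * t (y j)) ∎
    where
    distribʳ-sumR : ∀ {m} x (f : Fin m → A.Carrier) → sumR A f A.* x A.≈ sumR A (λ i → f i A.* x)
    distribʳ-sumR x f = ≈.begin
      sumR A f A.* x               ≈.≡⟨ cong (A._* x) (sumR≡sum f) ⟩
      ΣA.sum f A.* x               ≈.≈⟨ ΣA.*-distribʳ-sum x f ⟩
      ΣA.sum (λ i → f i A.* x)     ≈.≡⟨ sumR≡sum (λ i → f i A.* x) ⟨
      sumR A (λ i → f i A.* x)     ≈.∎

  t-comm : ∀ x y → t (x A.* y) ≡ t (y A.* x)
  t-comm x y = begin
    sumℤ (λ i → L (x A.* y) i i)                  ≡⟨ sumℤ-cong (λ i → L-* x y i i) ⟩
    sumℤ (λ i → sumℤ (λ k → L x i k * L y k i))   ≡⟨ sumℤ-comm (λ i k → L x i k * L y k i) ⟩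
    sumℤ (λ k → sumℤ (λ i → L x i k * L y k i))   ≡⟨ sumℤ-cong (λ k → sumℤ-cong (λ i → ℤP.*-comm (L x i k) (L y k i))) ⟩
    sumℤ (λ k → sumℤ (λ i → L y k i * L x i k))   ≡⟨ sumℤ-cong (λ k → sym (L-* y x k k)) ⟩
    sumℤ (λ k → L (y A.* x) k k)                  ∎

  w : Fin n → ℤ
  w = coord A.1#

  gram-symmetric : Symmetric (gram A β)
  gram-symmetric i j = t-comm (e i) (e j)

  gram·w : ∀ i → (gram A β ·ᵥ w) i ≡ t (e i)
  gram·w i = begin
    sumℤ (λ j → t (e i A.* e j) * w j)                      ≡⟨ sumℤ-cong (λ j → ℤP.*-comm (t (e i A.* e j)) (w j)) ⟩
    sumℤ (λ j → w j * t (e i A.* e j))                      ≡⟨ t-combination w (λ j → e i A.* e j) ⟨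
    t (sumR A (λ j → zmul A (w j) (e i A.* e j)))           ≡⟨ t-cong combination≈eᵢ ⟩
    t (e i)                                                 ∎
    where
    combination≈eᵢ : sumR A (λ j → zmul A (w j) (e i A.* e j)) A.≈ e i
    combination≈eᵢ = ≈.begin
      sumR A (λ j → zmul A (w j) (e i A.* e j))   ≈.≈⟨ sumR-cong (λ j → zmul-*ʳ (w j) (e i) (e j)) ⟨
      sumR A (λ j → e i A.* zmul A (w j) (e j))   ≈.≈⟨ *-distribˡ-sumR (e i) (λ j → zmul A (w j) (e j)) ⟨
      e i A.* sumR A (λ j → zmul A (w j) (e j))   ≈.≈⟨ A.*-congˡ (expand A.1#) ⟨
      e i A.* A.1#                                ≈.≈⟨ A.*-identityʳ (e i) ⟩
      e i                                         ≈.∎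

  gram-characteristic : Characteristic (gram A β) w
  gram-characteristic i = begin
    parity (t (e i A.* e i))                                       ≡⟨ cong parity (sumℤ-cong (λ a → L-* (e i) (e i) a a)) ⟩
    parity (sumℤ (λ a → sumℤ (λ k → L (e i) a k * L (e i) k a)))   ≡⟨ parity-trace-square (L (e i)) ⟩
    parity (t (e i))                                               ≡⟨ cong parity (gram·w i) ⟨
    parity ((gram A β ·ᵥ w) i)                                     ∎

  quadratic-gram : quadratic (gram A β) w ≡ + n
  quadratic-gram = begin
    sumℤ (λ i → w i * (gram A β ·ᵥ w) i)       ≡⟨ sumℤ-cong (λ i → cong (w i *_) (gram·w i)) ⟩
    sumℤ (λ i → w i * t (e i))                 ≡⟨ t-combination w e ⟨
    t (sumR A (λ j → zmul A (w j) (e j)))      ≡⟨ t-cong (expand A.1#) ⟨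
    t A.1#                                     ≡⟨ sumℤ-cong (λ a → trans (coord-cong (A.*-identityˡ (e a)) a) (coord-eₐ a)) ⟩
    sumℤ {n} (λ _ → + 1)                       ≡⟨ sumℤ-ones n ⟩
    + n                                        ∎
    where
    coord-eₐ : ∀ a → coord (e a) a ≡ + 1
    coord-eₐ a = trans (coord-cong (A.sym (sumR-δ a e)) a) (trans (unique (δ a) a) (δ-diagonal a))
    sumℤ-ones : ∀ m → sumℤ {m} (λ _ → + 1) ≡ + m
    sumℤ-ones zero    = refl
    sumℤ-ones (suc m) = cong (_+_ (+ 1)) (sumℤ-ones m)

theorem3p1 : {c ℓ : Level} (n : ℕ) → 1 ≤ n → (A : Ring c ℓ) (β : Basis A n) →
    (+ 4 ∣ disc A β) ⊎ (+ 4 ∣ (disc A β - + 1))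
theorem3p1 n _ A β =
  Sum.map ([_]₄≡0₄⇒4∣ (disc A β)) ([_]₄≡1₄⇒4∣-1 (disc A β)) (DetRelation-self⇒0or1 [ n ]ℕ₄ [ disc A β ]₄ relation)
  where
  open TraceForm A β using (w; gram-symmetric; gram-characteristic; quadratic-gram)
  relation : DetRelation [ n ]ℕ₄ [ disc A β ]₄ [ n ]ℕ₄
  relation = subst (λ Q → DetRelation [ n ]ℕ₄ [ disc A β ]₄ [ Q ]₄) quadratic-gram
                   (characteristic-det-relation n (gram A β) w gram-symmetric gram-characteristic)
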